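{- There is a unique function $G\mapsto H(G,s)\in\mathbb{Z}[s]$ on nonempty finite graphs satisfying (1) $H(G)=H(G-e)+H(G/e)-H(G-u)-H(G-v)$ for every edge $e$ of $G$ with distinct endpoints $u\neq v$; (2) $H(G_1+G_2)=H(G_1)H(G_2)$ for disjoint unions of nonempty graphs; (3) $H(K_1^n)=ns$ for all $n\geq 0$; and for every graph $G$ and every $k$, the coefficient of $s^k$ in $H(G,s)$ equals $h_k(G)$, the number of $k$-components Hamiltonian cycles of $G$.
   Context: Graphs are finite triples $G=(V,E,\varphi)$ with loops and multiple edges allowed, $\varphi$ mapping each edge to an unordered pair of (possibly equal) vertices. Degrees count loops twice. $G_1+G_2$ denotes the disjoint union. A $k$-components Hamiltonian cycle of $G$ is a spanning subgraph of $G$ with exactly $k$ connected components in which every vertex has degree $2$; these are counted as subgraphs. $K_1^n$ is the graph with one vertex and $n$ loops. For an edge $e$ with endpoints $u\neq v$: $G-e$ deletes $e$; $G/e$ deletes $e$ and identifies $u$ and $v$ (other edges between $u$ and $v$ become loops); $G-u$ deletes $u$ and all edges incident with it. -}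

module Defs where

open import Data.Nat as ℕ using (ℕ; zero; suc; _≤_; _<_)
open import Data.Integer as ℤ using (ℤ; +_)
open import Data.Bool using (Bool; true; false; _∧_; _∨_; not)
open import Data.Fin as Fin using (Fin; punchOut; _↑ˡ_; _↑ʳ_)
open import Data.Fin.Properties using () renaming (_≟_ to _≟ᶠ_)
open import Data.List as List using (List; []; _∷_; _++_; length; lookup; removeAt; map; filter; replicate; mapMaybe; allFin)
open import Data.Nat.ListAction using (sum)
open import Data.List.Relation.Binary.Permutation.Propositional using (_↭_)
open import Data.List.Relation.Binary.Pointwise using (Pointwise)
open import Data.Maybe using (Maybe; just; nothing)
open import Data.Product using (Σ; _×_; _,_; proj₁; proj₂; ∃)
open import Data.Sum using (_⊎_)
open import Function using (_∘_)
open import Function.Bundles using (_↔_; Inverse)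
open import Relation.Binary.PropositionalEquality using (_≡_; _≢_; sym)
open import Relation.Nullary using (yes; no; ¬_)
open import Relation.Nullary.Decidable using (⌊_⌋)

-- Polynomials in ℤ[s] as coefficient lists (constant term first),
-- compared coefficientwise (so trailing zeros are irrelevant).

Poly : Set
Poly = List ℤ

coeff : Poly → ℕ → ℤ
coeff []      _       = + 0
coeff (a ∷ p) zero    = a
coeff (a ∷ p) (suc k) = coeff p k

_≈ₚ_ : Poly → Poly → Set
p ≈ₚ q = ∀ k → coeff p k ≡ coeff q k

infixl 6 _+ₚ_ _-ₚ_
infixl 7 _*ₚ_
infix 4 _≈ₚ_

_+ₚ_ : Poly → Poly → Poly
[]      +ₚ q       = q
(a ∷ p) +ₚ []      = a ∷ p
(a ∷ p) +ₚ (b ∷ q) = (a ℤ.+ b) ∷ (p +ₚ q)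

-ₚ_ : Poly → Poly
-ₚ p = map ℤ.-_ p

_-ₚ_ : Poly → Poly → Poly
p -ₚ q = p +ₚ (-ₚ q)

_*ₚ_ : Poly → Poly → Poly
[]      *ₚ q = []
(a ∷ p) *ₚ q = map (a ℤ.*_) q +ₚ (+ 0 ∷ (p *ₚ q))

nS : ℕ → Poly
nS n = + 0 ∷ + n ∷ []

-- Vertices are Fin nV; the edges are the positions of the list `edges`;
-- the edge at a position joins the two (possibly equal) vertices of the
-- stored pair, read as an UNORDERED pair.

Edge : ℕ → Set
Edge n = Fin n × Fin n

record Graph : Set where
  constructor mkGraph
  field
    nV    : ℕ
    edges : List (Edge nV)
open Graph public

NonEmpty : Graph → Set
NonEmpty G = 1 ≤ nV G

SameEnds : ∀ {n} → Edge n → Edge n → Set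
SameEnds (a , b) (c , d) = (a ≡ c × b ≡ d) ⊎ (a ≡ d × b ≡ c)

mapEdge : ∀ {n m} → (Fin n → Fin m) → Edge n → Edge m
mapEdge f (a , b) = f a , f b

_≅_ : Graph → Graph → Set
G ≅ G' = Σ (Fin (nV G) ↔ Fin (nV G')) λ f →
           Σ (List (Edge (nV G'))) λ es →
             Pointwise SameEnds (map (mapEdge (Inverse.to f)) (edges G)) es
             × es ↭ edges G'

_⊕_ : Graph → Graph → Graph
mkGraph n es ⊕ mkGraph m fs =
  mkGraph (n ℕ.+ m) (map (mapEdge (_↑ˡ m)) es ++ map (mapEdge (n ↑ʳ_)) fs)

K1^ : ℕ → Graph
K1^ n = mkGraph 1 (replicate n (Fin.zero , Fin.zero))

deleteEdge : (G : Graph) → Fin (length (edges G)) → Graph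
deleteEdge (mkGraph n es) e = mkGraph n (removeAt es e)

deleteVertex : ∀ {n} → List (Edge (suc n)) → Fin (suc n) → Graph
deleteVertex {n} es u = mkGraph n (mapMaybe keep es)
  where
  keep : Edge (suc n) → Maybe (Edge n)
  keep (a , b) with u ≟ᶠ a | u ≟ᶠ b
  ... | no u≢a | no u≢b = just (punchOut u≢a , punchOut u≢b)
  ... | _      | _      = nothing

-- G / e for an edge e with ends u ≠ v: delete e and identify v with u
-- (vertex v is removed, every end at v is redirected to u).
contract : ∀ {n} (es : List (Edge (suc n))) (e : Fin (length es)) →
           proj₁ (lookup es e) ≢ proj₂ (lookup es e) → Graph
contract {n} es e u≢v = mkGraph n (map (mapEdge φ) (removeAt es e))
  where
  u v : Fin (suc n)
  u = proj₁ (lookup es e)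
  v = proj₂ (lookup es e)
  φ : Fin (suc n) → Fin n
  φ w with w ≟ᶠ v
  ... | yes _   = punchOut {i = v} {j = u} (u≢v ∘ sym)
  ... | no w≢v  = punchOut {i = v} {j = w} (w≢v ∘ sym)

-- all sub-multisets of the edge list (subsets of edge positions)
subsets : ∀ {A : Set} → List A → List (List A)
subsets []       = [] ∷ []
subsets (x ∷ xs) = map (x ∷_) (subsets xs) ++ subsets xs

_==_ : ∀ {n} → Fin n → Fin n → Bool
a == b = ⌊ a ≟ᶠ b ⌋

count : List Bool → ℕ
count bs = length (filter (λ b → b ≟B true) bs)
  where
  open import Data.Bool.Properties using () renaming (_≟_ to _≟B_)

-- degree of w in the edge list S (a loop counts twice)
degree : ∀ {n} → List (Edge n) → Fin n → ℕ
degree S w = sum (map (λ { (a , b) → count ((a == w) ∷ (b == w) ∷ []) }) S)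

allB : List Bool → Bool
allB = List.foldr _∧_ true

anyB : List Bool → Bool
anyB = List.foldr _∨_ false

twoRegular : ∀ {n} → List (Edge n) → Bool
twoRegular {n} S = allB (map (λ w → ⌊ degree S w ℕ.≟ 2 ⌋) (allFin n))

step : ∀ {n} → List (Edge n) → (Fin n → Bool) → (Fin n → Bool)
step S R w = R w ∨ anyB (map (λ { (a , b) → (R a ∧ (b == w)) ∨ (R b ∧ (a == w)) }) S)

iter : ∀ {A : Set} → ℕ → (A → A) → A → A
iter zero    f x = x
iter (suc k) f x = f (iter k f x)

-- reach S x y : y is joined to x by a walk in (V, S)
-- (walks of length < n suffice, so n steps compute reachability exactly)
reach : ∀ {n} → List (Edge n) → Fin n → Fin n → Bool
reach {n} S x = iter n (step S) (λ y → y == x)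

-- number of connected components of the spanning subgraph (V, S):
-- the number of vertices that are the least vertex of their component
components : ∀ {n} → List (Edge n) → ℕ
components {n} S =
  count (map (λ w → not (anyB (map (λ w' → ⌊ Fin.toℕ w' ℕ.<? Fin.toℕ w ⌋ ∧ reach S w w')
                                   (allFin n))))
             (allFin n))

-- h_k(G): number of spanning subgraphs with exactly k components in
-- which every vertex has degree 2
h : ℕ → Graph → ℕ
h k (mkGraph n es) =
  length (filter (λ S → twoRegular S ∧ ⌊ components S ℕ.≟ k ⌋ ≟B true) (subsets es))
  where
  open import Data.Bool.Properties using () renaming (_≟_ to _≟B_)

-- The axioms (1)–(3) for a function H on nonempty graphs, plus
-- invariance under isomorphism (graphs being considered up to iso).

IsoInvariant : (Graph → Poly) → Set
IsoInvariant H = ∀ G G' → NonEmpty G → NonEmpty G' → G ≅ G' → H G ≈ₚ H G'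

Axiom1 : (Graph → Poly) → Set
Axiom1 H = ∀ n (es : List (Edge (suc n))) (e : Fin (length es))
             (u≢v : proj₁ (lookup es e) ≢ proj₂ (lookup es e)) →
           H (mkGraph (suc n) es) ≈ₚ
             H (deleteEdge (mkGraph (suc n) es) e) +ₚ H (contract es e u≢v)
               -ₚ H (deleteVertex es (proj₁ (lookup es e)))
               -ₚ H (deleteVertex es (proj₂ (lookup es e)))

Axiom2 : (Graph → Poly) → Set
Axiom2 H = ∀ G₁ G₂ → NonEmpty G₁ → NonEmpty G₂ → H (G₁ ⊕ G₂) ≈ₚ H G₁ *ₚ H G₂

Axiom3 : (Graph → Poly) → Set
Axiom3 H = ∀ n → H (K1^ n) ≈ₚ nS n

Admissible : (Graph → Poly) → Set
Admissible H = IsoInvariant H × Axiom1 H × Axiom2 H × Axiom3 H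

-- H(G, s) = ∑ s^c(S) over the spanning subgraphs S of G that are 2-regular,
-- c(S) being the number of components of S; its coefficients are the h_k by
-- definition. For an edge e = uv that is not a loop, split the subgraphs S
-- of G - e by the degrees d_u, d_v of u and v: S + e, S in G - u and S in
-- G - v are 2-regular exactly when (d_u , d_v) = (1 , 1), (0 , 2) and (2 , 0)
-- (all other degrees being 2), which are exactly the solutions of
-- d_u + d_v = 2, the condition for S / e to be 2-regular in G / e; and the
-- number of components is the same in all four graphs. This gives (1);
-- subgraphs of a disjoint union are pairs, giving (2), and in K₁ⁿ only the
-- n single loops count, giving (3). Conversely (1) removes non-loop edges
-- one at a time, and a graph with only loops is K₁ᵃ ⊕ G′ up to isomorphism,
-- so (2) and (3) determine H by induction on |V| + |E|.
module Submission where

open import Defs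

open import Data.Bool using (Bool; true; false; _∧_; _∨_; not; if_then_else_)
import Data.Bool.Properties as BoolP
open import Data.Empty using (⊥-elim)
open import Data.Fin as Fin using (Fin; zero; suc; punchIn; punchOut; toℕ; _↑ˡ_; _↑ʳ_)
import Data.Fin.Properties as FinP
open import Data.Fin.Permutation as Perm using (Permutation; _⟨$⟩ʳ_; _⟨$⟩ˡ_)
open import Data.Integer as ℤ using (ℤ; 0ℤ; 1ℤ)
import Data.Integer.Properties as ℤP
import Data.Integer.Tactic.RingSolver as ℤ-Solver
open import Data.List using (List; []; _∷_; _++_; length; lookup; removeAt; map; mapMaybe; filter; replicate; allFin; tabulate)
import Data.List.Properties as ListP
open import Data.List.Membership.Propositional using (_∈_)
open import Data.List.Membership.Propositional.Properties using (∈-map⁺; ∈-map⁻; ∈-++⁺ˡ; ∈-++⁺ʳ; ∈-++⁻)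
open import Data.List.Relation.Binary.Permutation.Propositional as ↭ using (_↭_; prep; swap; ↭-trans; ↭-sym)
import Data.List.Relation.Binary.Permutation.Propositional.Properties as ↭P
open import Data.List.Relation.Binary.Pointwise using (Pointwise; []; _∷_)
open import Data.List.Relation.Unary.All using (All; []; _∷_)
open import Data.List.Relation.Unary.Any using (here; there)
open import Data.Maybe using (Maybe; just; nothing; is-just)
open import Data.Nat as ℕ using (ℕ; zero; suc; _+_; _≤_; _<_; z≤n; s≤s)
import Data.Nat.Properties as ℕP
import Data.Nat.Tactic.RingSolver as ℕ-Solver
open import Data.Product using (Σ; _×_; _,_; proj₁; proj₂; ∃)
open import Data.Sum using (_⊎_; inj₁; inj₂)
open import Function using (_∘_; id; Inverse)
open import Function.Construct.Identity using (↔-id)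
open import Relation.Binary using (Setoid; tri<; tri≈; tri>)
open import Relation.Binary.PropositionalEquality
open import Relation.Nullary using (¬_; Dec; yes; no)
open import Relation.Nullary.Decidable using (⌊_⌋)
open import Algebra.Properties.CommutativeMonoid.Sum ℕP.+-0-commutativeMonoid using (sum; sum-remove; ∑-distrib-+; sum-cong-≗)
open import Algebra.Properties.CommutativeSemigroup ℕP.+-commutativeSemigroup using (interchange; x∙yz≈y∙xz)
import Algebra.Properties.CommutativeSemigroup ℤP.+-commutativeSemigroup as ℤ+

⌊⌋-cong : ∀ {A B : Set} → (A → B) → (B → A) → (a? : Dec A) (b? : Dec B) → ⌊ a? ⌋ ≡ ⌊ b? ⌋
⌊⌋-cong f g (yes a) (yes b) = refl
⌊⌋-cong f g (yes a) (no ¬b) = ⊥-elim (¬b (f a))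
⌊⌋-cong f g (no ¬a) (yes b) = ⊥-elim (¬a (g b))
⌊⌋-cong f g (no ¬a) (no ¬b) = refl

⟦_⟧ : Bool → ℕ
⟦ true  ⟧ = 1
⟦ false ⟧ = 0

count-∷ : ∀ b bs → count (b ∷ bs) ≡ ⟦ b ⟧ + count bs
count-∷ true  bs = refl
count-∷ false bs = refl

∨≡true⇒ : ∀ {a b} → a ∨ b ≡ true → a ≡ true ⊎ b ≡ true
∨≡true⇒ {true}  _ = inj₁ refl
∨≡true⇒ {false} e = inj₂ e

∧≡true⇒ : ∀ {a b} → a ∧ b ≡ true → a ≡ true × b ≡ true
∧≡true⇒ {true} {true} _ = refl , refl

∧-true : ∀ {a b} → a ≡ true → b ≡ true → a ∧ b ≡ true
∧-true refl refl = refl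

∨-trueʳ : ∀ a {b} → b ≡ true → a ∨ b ≡ true
∨-trueʳ true  _ = refl
∨-trueʳ false e = e

not≡true⇒ : ∀ {a} → not a ≡ true → a ≡ false
not≡true⇒ {false} _ = refl

not≡false⇒ : ∀ {a} → not a ≡ false → a ≡ true
not≡false⇒ {true} _ = refl

false≢true : false ≢ true
false≢true ()

≢true⇒ : ∀ {a} → a ≢ true → a ≡ false
≢true⇒ {true}  a≢true = ⊥-elim (a≢true refl)
≢true⇒ {false} _      = refl

bool-ext : ∀ {a b} → (a ≡ true → b ≡ true) → (b ≡ true → a ≡ true) → a ≡ b
bool-ext {true}  {true}  f g = refl
bool-ext {true}  {false} f g = sym (f refl)
bool-ext {false} {true}  f g = g refl
bool-ext {false} {false} f g = refl

⌊⌋≡true⇒ : ∀ {P : Set} (p? : Dec P) → ⌊ p? ⌋ ≡ true → P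
⌊⌋≡true⇒ (yes p) _ = p

⌊⌋-true : ∀ {P : Set} (p? : Dec P) → P → ⌊ p? ⌋ ≡ true
⌊⌋-true (yes _) _ = refl
⌊⌋-true (no ¬p) p = ⊥-elim (¬p p)

⌊⌋-false : ∀ {P : Set} (p? : Dec P) → ¬ P → ⌊ p? ⌋ ≡ false
⌊⌋-false (yes p) ¬p = ⊥-elim (¬p p)
⌊⌋-false (no _)  _  = refl

==⇒≡ : ∀ {n} {a b : Fin n} → (a == b) ≡ true → a ≡ b
==⇒≡ {a = a} {b} = ⌊⌋≡true⇒ (a FinP.≟ b)

≡⇒== : ∀ {n} {a b : Fin n} → a ≡ b → (a == b) ≡ true
≡⇒== {a = a} {b} = ⌊⌋-true (a FinP.≟ b)

==-refl : ∀ {n} (a : Fin n) → (a == a) ≡ true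
==-refl a = ≡⇒== refl

≢⇒==false : ∀ {n} {a b : Fin n} → a ≢ b → (a == b) ≡ false
≢⇒==false {a = a} {b} = ⌊⌋-false (a FinP.≟ b)

==-cong : ∀ {n m} {a b : Fin n} {c d : Fin m} → (a ≡ b → c ≡ d) → (c ≡ d → a ≡ b) → (a == b) ≡ (c == d)
==-cong {a = a} {b} {c} {d} f g = ⌊⌋-cong f g (a FinP.≟ b) (c FinP.≟ d)

anyF : ∀ {n} → (Fin n → Bool) → Bool
anyF {zero}  p = false
anyF {suc n} p = p zero ∨ anyF (p ∘ suc)

allF : ∀ {n} → (Fin n → Bool) → Bool
allF {zero}  p = true
allF {suc n} p = p zero ∧ allF (p ∘ suc)

count-allFin : ∀ {n} (g : Fin n → Bool) → count (map g (allFin n)) ≡ sum (⟦_⟧ ∘ g)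
count-allFin {n} g = trans (cong count (ListP.map-tabulate id g)) (count-tabulate g)
  where
  count-tabulate : ∀ {n} (g : Fin n → Bool) → count (tabulate g) ≡ sum (⟦_⟧ ∘ g)
  count-tabulate {zero}  g = refl
  count-tabulate {suc n} g = trans (count-∷ (g zero) _) (cong (⟦ g zero ⟧ +_) (count-tabulate (g ∘ suc)))

anyB-allFin : ∀ {n} (g : Fin n → Bool) → anyB (map g (allFin n)) ≡ anyF g
anyB-allFin {n} g = trans (cong anyB (ListP.map-tabulate id g)) (anyB-tabulate g)
  where
  anyB-tabulate : ∀ {n} (g : Fin n → Bool) → anyB (tabulate g) ≡ anyF g
  anyB-tabulate {zero}  g = refl
  anyB-tabulate {suc n} g = cong (g zero ∨_) (anyB-tabulate (g ∘ suc))

allB-allFin : ∀ {n} (g : Fin n → Bool) → allB (map g (allFin n)) ≡ allF g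
allB-allFin {n} g = trans (cong allB (ListP.map-tabulate id g)) (allB-tabulate g)
  where
  allB-tabulate : ∀ {n} (g : Fin n → Bool) → allB (tabulate g) ≡ allF g
  allB-tabulate {zero}  g = refl
  allB-tabulate {suc n} g = cong (g zero ∧_) (allB-tabulate (g ∘ suc))

anyF⇒∃ : ∀ {n} (p : Fin n → Bool) → anyF p ≡ true → ∃ λ i → p i ≡ true
anyF⇒∃ {suc n} p e with ∨≡true⇒ {p zero} e
... | inj₁ p0 = zero , p0
... | inj₂ ps with anyF⇒∃ (p ∘ suc) ps
...   | i , pi = suc i , pi

∃⇒anyF : ∀ {n} (p : Fin n → Bool) i → p i ≡ true → anyF p ≡ true
∃⇒anyF p zero    e rewrite e = refl
∃⇒anyF p (suc i) e = ∨-trueʳ (p zero) (∃⇒anyF (p ∘ suc) i e)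

anyF-false : ∀ {n} (p : Fin n → Bool) → (∀ i → p i ≡ false) → anyF p ≡ false
anyF-false p none = ≢true⇒ λ e → let (i , pi) = anyF⇒∃ p e in false≢true (trans (sym (none i)) pi)

anyF-cong : ∀ {n} {p q : Fin n → Bool} → (∀ i → p i ≡ q i) → anyF p ≡ anyF q
anyF-cong {zero}  e = refl
anyF-cong {suc n} e = cong₂ _∨_ (e zero) (anyF-cong (e ∘ suc))

allF⇒∀ : ∀ {n} (p : Fin n → Bool) → allF p ≡ true → ∀ i → p i ≡ true
allF⇒∀ {suc n} p e zero    = proj₁ (∧≡true⇒ e)
allF⇒∀ {suc n} p e (suc i) = allF⇒∀ (p ∘ suc) (proj₂ (∧≡true⇒ {p zero} e)) i

∀⇒allF : ∀ {n} (p : Fin n → Bool) → (∀ i → p i ≡ true) → allF p ≡ true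
∀⇒allF {zero}  p all = refl
∀⇒allF {suc n} p all rewrite all zero = ∀⇒allF (p ∘ suc) (all ∘ suc)

sum-↑ : ∀ n m (f : Fin (n + m) → ℕ) → sum f ≡ sum (λ i → f (i ↑ˡ m)) + sum (λ j → f (n ↑ʳ j))
sum-↑ zero    m f = refl
sum-↑ (suc n) m f rewrite sum-↑ n m (f ∘ suc) = sym (ℕP.+-assoc (f zero) _ _)

anyF-↑ : ∀ n m (p : Fin (n + m) → Bool) → anyF p ≡ anyF (λ i → p (i ↑ˡ m)) ∨ anyF (λ j → p (n ↑ʳ j))
anyF-↑ zero    m p = refl
anyF-↑ (suc n) m p rewrite anyF-↑ n m (p ∘ suc) = sym (BoolP.∨-assoc (p zero) _ _)

sum-⟦⟧≤ : ∀ {n} (g : Fin n → Bool) → sum (⟦_⟧ ∘ g) ≤ n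
sum-⟦⟧≤ {zero}  g = z≤n
sum-⟦⟧≤ {suc n} g with g zero
... | true  = s≤s (sum-⟦⟧≤ (g ∘ suc))
... | false = ℕP.m≤n⇒m≤1+n (sum-⟦⟧≤ (g ∘ suc))

sum-⟦⟧-zero : ∀ {n} (g : Fin n → Bool) → (∀ i → g i ≡ false) → sum (⟦_⟧ ∘ g) ≡ 0
sum-⟦⟧-zero {zero}  g none = refl
sum-⟦⟧-zero {suc n} g none rewrite none zero = sum-⟦⟧-zero (g ∘ suc) (none ∘ suc)

sum-⟦⟧-one : ∀ {n} (g : Fin n → Bool) j → g j ≡ true → (∀ i → g i ≡ true → i ≡ j) → sum (⟦_⟧ ∘ g) ≡ 1
sum-⟦⟧-one {suc n} g j gj only rewrite sum-remove {i = j} (⟦_⟧ ∘ g) | gj =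
  cong suc (sum-⟦⟧-zero (g ∘ punchIn j) λ i → ≢true⇒ λ e → FinP.punchInᵢ≢i j i (only _ e))

sum-≥-term : ∀ {m} (f : Fin m → ℕ) j → f j ≤ sum f
sum-≥-term {suc m} f j rewrite sum-remove {i = j} f = ℕP.m≤m+n _ _

sum-mono-≤ : ∀ {m} {f g : Fin m → ℕ} → (∀ i → f i ≤ g i) → sum f ≤ sum g
sum-mono-≤ {zero}  le = z≤n
sum-mono-≤ {suc m} le = ℕP.+-mono-≤ (le zero) (sum-mono-≤ (le ∘ suc))

sum-mono-< : ∀ {m} {f g : Fin m → ℕ} → (∀ i → f i ≤ g i) → ∀ j → f j < g j → sum f < sum g
sum-mono-< {suc m} {f} {g} le j lt rewrite sum-remove {i = j} f | sum-remove {i = j} g =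
  ℕP.+-mono-<-≤ lt (sum-mono-≤ (le ∘ punchIn j))

allJust : ∀ {A B : Set} → (A → Maybe B) → List A → Bool
allJust f []       = true
allJust f (a ∷ as) = is-just (f a) ∧ allJust f as

coeff-+ₚ : ∀ p q k → coeff (p +ₚ q) k ≡ coeff p k ℤ.+ coeff q k
coeff-+ₚ []      q       k       = sym (ℤP.+-identityˡ _)
coeff-+ₚ (a ∷ p) []      k       = sym (ℤP.+-identityʳ _)
coeff-+ₚ (a ∷ p) (b ∷ q) zero    = refl
coeff-+ₚ (a ∷ p) (b ∷ q) (suc k) = coeff-+ₚ p q k

coeff-negₚ : ∀ p k → coeff (-ₚ p) k ≡ ℤ.- coeff p k
coeff-negₚ []      k       = refl
coeff-negₚ (a ∷ p) zero    = refl
coeff-negₚ (a ∷ p) (suc k) = coeff-negₚ p k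

coeff-subₚ : ∀ p q k → coeff (p -ₚ q) k ≡ coeff p k ℤ.- coeff q k
coeff-subₚ p q k = trans (coeff-+ₚ p (-ₚ q) k) (cong (λ x → coeff p k ℤ.+ x) (coeff-negₚ q k))

coeff-scale : ∀ a q k → coeff (map (a ℤ.*_) q) k ≡ a ℤ.* coeff q k
coeff-scale a []      k       = sym (ℤP.*-zeroʳ a)
coeff-scale a (b ∷ q) zero    = refl
coeff-scale a (b ∷ q) (suc k) = coeff-scale a q k

convolve : (ℕ → ℤ) → (ℕ → ℤ) → ℕ → ℤ
convolve f g zero    = f 0 ℤ.* g 0
convolve f g (suc k) = f 0 ℤ.* g (suc k) ℤ.+ convolve (f ∘ suc) g k

coeff-*ₚ : ∀ p q k → coeff (p *ₚ q) k ≡ convolve (coeff p) (coeff q) k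
coeff-*ₚ []      q k       = sym (convolve-zeroˡ (coeff q) k)
  where
  convolve-zeroˡ : ∀ g k → convolve (λ _ → 0ℤ) g k ≡ 0ℤ
  convolve-zeroˡ g zero    = refl
  convolve-zeroˡ g (suc k) = trans (ℤP.+-identityˡ _) (convolve-zeroˡ g k)
coeff-*ₚ (a ∷ p) q zero    =
  trans (coeff-+ₚ (map (a ℤ.*_) q) (0ℤ ∷ (p *ₚ q)) 0) (trans (ℤP.+-identityʳ _) (coeff-scale a q 0))
coeff-*ₚ (a ∷ p) q (suc k) =
  trans (coeff-+ₚ (map (a ℤ.*_) q) (0ℤ ∷ (p *ₚ q)) (suc k)) (cong₂ ℤ._+_ (coeff-scale a q (suc k)) (coeff-*ₚ p q k))

convolve-cong : ∀ {f f′ g g′} → (∀ i → f i ≡ f′ i) → (∀ i → g i ≡ g′ i) → ∀ k → convolve f g k ≡ convolve f′ g′ k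
convolve-cong f≗ g≗ zero    = cong₂ ℤ._*_ (f≗ 0) (g≗ 0)
convolve-cong f≗ g≗ (suc k) = cong₂ ℤ._+_ (cong₂ ℤ._*_ (f≗ 0) (g≗ (suc k))) (convolve-cong (f≗ ∘ suc) g≗ k)

convolve-distribʳ : ∀ f f′ g k → convolve (λ i → f i ℤ.+ f′ i) g k ≡ convolve f g k ℤ.+ convolve f′ g k
convolve-distribʳ f f′ g zero    = ℤP.*-distribʳ-+ (g 0) (f 0) (f′ 0)
convolve-distribʳ f f′ g (suc k) =
  trans (cong₂ ℤ._+_ (ℤP.*-distribʳ-+ (g (suc k)) (f 0) (f′ 0)) (convolve-distribʳ (f ∘ suc) (f′ ∘ suc) g k))
        (ℤ+.interchange (f 0 ℤ.* g (suc k)) (f′ 0 ℤ.* g (suc k)) (convolve (f ∘ suc) g k) (convolve (f′ ∘ suc) g k))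

convolve-distribˡ : ∀ f g g′ k → convolve f (λ i → g i ℤ.+ g′ i) k ≡ convolve f g k ℤ.+ convolve f g′ k
convolve-distribˡ f g g′ zero    = ℤP.*-distribˡ-+ (f 0) (g 0) (g′ 0)
convolve-distribˡ f g g′ (suc k) =
  trans (cong₂ ℤ._+_ (ℤP.*-distribˡ-+ (f 0) (g (suc k)) (g′ (suc k))) (convolve-distribˡ (f ∘ suc) g g′ k))
        (ℤ+.interchange (f 0 ℤ.* g (suc k)) (f 0 ℤ.* g′ (suc k)) (convolve (f ∘ suc) g k) (convolve (f ∘ suc) g′ k))

convolve-zeroʳ : ∀ f k → convolve f (λ _ → 0ℤ) k ≡ 0ℤ
convolve-zeroʳ f zero    = ℤP.*-zeroʳ (f 0)
convolve-zeroʳ f (suc k) =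
  trans (cong (ℤ._+ convolve (f ∘ suc) _ k) (ℤP.*-zeroʳ (f 0))) (trans (ℤP.+-identityˡ _) (convolve-zeroʳ (f ∘ suc) k))

-- A record around _≈ₚ_, so that the two polynomials can be inferred.
infix 4 _≋_
record _≋_ (p q : Poly) : Set where
  constructor mk≋
  field get : p ≈ₚ q
open _≋_ public

≋-setoid : Setoid _ _
≋-setoid = record
  { Carrier       = Poly
  ; _≈_           = _≋_
  ; isEquivalence = record
    { refl  = mk≋ λ _ → refl
    ; sym   = λ (mk≋ e) → mk≋ λ k → sym (e k)
    ; trans = λ (mk≋ e) (mk≋ f) → mk≋ λ k → trans (e k) (f k)
    }
  }

open Setoid ≋-setoid public using () renaming (refl to ≋-refl; sym to ≋-sym; trans to ≋-trans)

+ₚ-cong : ∀ {p p′ q q′} → p ≋ p′ → q ≋ q′ → p +ₚ q ≋ p′ +ₚ q′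
+ₚ-cong {p} {p′} {q} {q′} (mk≋ e) (mk≋ f) =
  mk≋ λ k → trans (coeff-+ₚ p q k) (trans (cong₂ ℤ._+_ (e k) (f k)) (sym (coeff-+ₚ p′ q′ k)))

-ₚ-cong : ∀ {p p′ q q′} → p ≋ p′ → q ≋ q′ → p -ₚ q ≋ p′ -ₚ q′
-ₚ-cong {p} {p′} {q} {q′} (mk≋ e) (mk≋ f) =
  mk≋ λ k → trans (coeff-subₚ p q k) (trans (cong₂ ℤ._-_ (e k) (f k)) (sym (coeff-subₚ p′ q′ k)))

*ₚ-cong : ∀ {p p′ q q′} → p ≋ p′ → q ≋ q′ → p *ₚ q ≋ p′ *ₚ q′
*ₚ-cong {p} {p′} {q} {q′} (mk≋ e) (mk≋ f) =
  mk≋ λ k → trans (coeff-*ₚ p q k) (trans (convolve-cong e f k) (sym (coeff-*ₚ p′ q′ k)))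

*ₚ-distribʳ-+ₚ : ∀ p q r → (p +ₚ q) *ₚ r ≋ p *ₚ r +ₚ q *ₚ r
*ₚ-distribʳ-+ₚ p q r = mk≋ λ k → begin
  coeff ((p +ₚ q) *ₚ r) k                                ≡⟨ coeff-*ₚ (p +ₚ q) r k ⟩
  convolve (coeff (p +ₚ q)) (coeff r) k                  ≡⟨ convolve-cong (coeff-+ₚ p q) (λ _ → refl) k ⟩
  convolve (λ i → coeff p i ℤ.+ coeff q i) (coeff r) k   ≡⟨ convolve-distribʳ (coeff p) (coeff q) (coeff r) k ⟩
  convolve (coeff p) (coeff r) k ℤ.+ convolve (coeff q) (coeff r) k
    ≡⟨ cong₂ ℤ._+_ (coeff-*ₚ p r k) (coeff-*ₚ q r k) ⟨
  coeff (p *ₚ r) k ℤ.+ coeff (q *ₚ r) k                  ≡⟨ coeff-+ₚ (p *ₚ r) (q *ₚ r) k ⟨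
  coeff (p *ₚ r +ₚ q *ₚ r) k                             ∎
  where open ≡-Reasoning

*ₚ-distribˡ-+ₚ : ∀ r p q → r *ₚ (p +ₚ q) ≋ r *ₚ p +ₚ r *ₚ q
*ₚ-distribˡ-+ₚ r p q = mk≋ λ k → begin
  coeff (r *ₚ (p +ₚ q)) k                                ≡⟨ coeff-*ₚ r (p +ₚ q) k ⟩
  convolve (coeff r) (coeff (p +ₚ q)) k                  ≡⟨ convolve-cong (λ _ → refl) (coeff-+ₚ p q) k ⟩
  convolve (coeff r) (λ i → coeff p i ℤ.+ coeff q i) k   ≡⟨ convolve-distribˡ (coeff r) (coeff p) (coeff q) k ⟩
  convolve (coeff r) (coeff p) k ℤ.+ convolve (coeff r) (coeff q) k
    ≡⟨ cong₂ ℤ._+_ (coeff-*ₚ r p k) (coeff-*ₚ r q k) ⟨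
  coeff (r *ₚ p) k ℤ.+ coeff (r *ₚ q) k                  ≡⟨ coeff-+ₚ (r *ₚ p) (r *ₚ q) k ⟨
  coeff (r *ₚ p +ₚ r *ₚ q) k                             ∎
  where open ≡-Reasoning

*ₚ-zeroʳ : ∀ p → p *ₚ [] ≋ []
*ₚ-zeroʳ p = mk≋ λ k → trans (coeff-*ₚ p [] k) (convolve-zeroʳ (coeff p) k)

s^_ : ℕ → Poly
s^ c = replicate c 0ℤ ++ (1ℤ ∷ [])

coeff-s^ : ∀ c k → coeff (s^ c) k ≡ ℤ.+ ⟦ ⌊ c ℕ.≟ k ⌋ ⟧
coeff-s^ zero    zero    = refl
coeff-s^ zero    (suc k) = refl
coeff-s^ (suc c) zero    = refl
coeff-s^ (suc c) (suc k) =
  trans (coeff-s^ c k) (cong (λ b → ℤ.+ ⟦ b ⟧) (⌊⌋-cong (cong suc) ℕP.suc-injective (c ℕ.≟ k) (suc c ℕ.≟ suc k)))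

s^-*ₚ : ∀ c q → s^ c *ₚ q ≋ replicate c 0ℤ ++ q
s^-*ₚ zero    q = mk≋ λ k → begin
  coeff (map (1ℤ ℤ.*_) q +ₚ (0ℤ ∷ [])) k         ≡⟨ coeff-+ₚ (map (1ℤ ℤ.*_) q) (0ℤ ∷ []) k ⟩
  coeff (map (1ℤ ℤ.*_) q) k ℤ.+ coeff (0ℤ ∷ []) k  ≡⟨ cong₂ ℤ._+_ (trans (coeff-scale 1ℤ q k) (ℤP.*-identityˡ _)) (zero-coeff k) ⟩
  coeff q k ℤ.+ 0ℤ                                 ≡⟨ ℤP.+-identityʳ _ ⟩
  coeff q k                                         ∎
  where
  open ≡-Reasoning
  zero-coeff : ∀ k → coeff (0ℤ ∷ []) k ≡ 0ℤ
  zero-coeff zero    = refl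
  zero-coeff (suc k) = refl
s^-*ₚ (suc c) q = mk≋ λ k →
  trans (coeff-+ₚ (map (0ℤ ℤ.*_) q) (0ℤ ∷ (s^ c *ₚ q)) k)
        (trans (cong (ℤ._+ coeff (0ℤ ∷ (s^ c *ₚ q)) k) (trans (coeff-scale 0ℤ q k) (ℤP.*-zeroˡ (coeff q k)))) (shifted k))
  where
  shifted : ∀ k → 0ℤ ℤ.+ coeff (0ℤ ∷ (s^ c *ₚ q)) k ≡ coeff (replicate (suc c) 0ℤ ++ q) k
  shifted zero    = refl
  shifted (suc k) = trans (ℤP.+-identityˡ _) (get (s^-*ₚ c q) k)

s^-+ : ∀ c d → s^ c *ₚ s^ d ≋ s^ (c + d)
s^-+ c d = ≋-trans (s^-*ₚ c (s^ d)) (mk≋ λ k → cong (λ p → coeff p k) (padding c))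
  where
  padding : ∀ c → replicate c 0ℤ ++ s^ d ≡ s^ (c + d)
  padding zero    = refl
  padding (suc c) = cong (0ℤ ∷_) (padding c)

s^_if_ : ℕ → Bool → Poly
s^ c if b = if b then s^ c else []

coeff-s^-if : ∀ c b k → coeff (s^ c if b) k ≡ ℤ.+ ⟦ b ∧ ⌊ c ℕ.≟ k ⌋ ⟧
coeff-s^-if c true  k = coeff-s^ c k
coeff-s^-if c false k = refl

s^-if-* : ∀ c d a b → s^ (c + d) if (a ∧ b) ≋ (s^ c if a) *ₚ (s^ d if b)
s^-if-* c d true  true  = ≋-sym (s^-+ c d)
s^-if-* c d true  false = ≋-sym (*ₚ-zeroʳ (s^ c))
s^-if-* c d false b     = ≋-refl

module _ {A : Set} where

  ∑ₚ-sub : (List A → Poly) → List A → Poly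
  ∑ₚ-sub f []       = f []
  ∑ₚ-sub f (x ∷ xs) = ∑ₚ-sub (f ∘ (x ∷_)) xs +ₚ ∑ₚ-sub f xs

  ∑ₚ-sub-cong : ∀ {f g : List A → Poly} → (∀ S → f S ≋ g S) → ∀ xs → ∑ₚ-sub f xs ≋ ∑ₚ-sub g xs
  ∑ₚ-sub-cong f≋g []       = f≋g []
  ∑ₚ-sub-cong f≋g (x ∷ xs) = +ₚ-cong (∑ₚ-sub-cong (f≋g ∘ (x ∷_)) xs) (∑ₚ-sub-cong f≋g xs)

  ∑ₚ-sub-++ : ∀ (f : List A → Poly) xs ys → ∑ₚ-sub f (xs ++ ys) ≡ ∑ₚ-sub (λ S → ∑ₚ-sub (λ T → f (S ++ T)) ys) xs
  ∑ₚ-sub-++ f []       ys = refl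
  ∑ₚ-sub-++ f (x ∷ xs) ys = cong₂ _+ₚ_ (∑ₚ-sub-++ (f ∘ (x ∷_)) xs ys) (∑ₚ-sub-++ f xs ys)

  ∑ₚ-sub-*ₚʳ : ∀ (f : List A → Poly) q xs → ∑ₚ-sub f xs *ₚ q ≋ ∑ₚ-sub (λ S → f S *ₚ q) xs
  ∑ₚ-sub-*ₚʳ f q []       = ≋-refl
  ∑ₚ-sub-*ₚʳ f q (x ∷ xs) =
    ≋-trans (*ₚ-distribʳ-+ₚ (∑ₚ-sub (f ∘ (x ∷_)) xs) (∑ₚ-sub f xs) q)
            (+ₚ-cong (∑ₚ-sub-*ₚʳ (f ∘ (x ∷_)) q xs) (∑ₚ-sub-*ₚʳ f q xs))

  ∑ₚ-sub-*ₚˡ : ∀ p (f : List A → Poly) xs → p *ₚ ∑ₚ-sub f xs ≋ ∑ₚ-sub (λ S → p *ₚ f S) xs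
  ∑ₚ-sub-*ₚˡ p f []       = ≋-refl
  ∑ₚ-sub-*ₚˡ p f (x ∷ xs) =
    ≋-trans (*ₚ-distribˡ-+ₚ p (∑ₚ-sub (f ∘ (x ∷_)) xs) (∑ₚ-sub f xs))
            (+ₚ-cong (∑ₚ-sub-*ₚˡ p (f ∘ (x ∷_)) xs) (∑ₚ-sub-*ₚˡ p f xs))

∑ₚ-sub-map : ∀ {A B : Set} (f : List B → Poly) (g : A → B) xs → ∑ₚ-sub f (map g xs) ≡ ∑ₚ-sub (f ∘ map g) xs
∑ₚ-sub-map f g []       = refl
∑ₚ-sub-map f g (x ∷ xs) = cong₂ _+ₚ_ (∑ₚ-sub-map (f ∘ (g x ∷_)) g xs) (∑ₚ-sub-map f g xs)

-- Connectivity, and correctness of `reach`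

data Conn {n} (S : List (Edge n)) : Fin n → Fin n → Set where
  conn-edge  : ∀ {a b} → (a , b) ∈ S → Conn S a b
  conn-refl  : ∀ {a} → Conn S a a
  conn-sym   : ∀ {a b} → Conn S a b → Conn S b a
  conn-trans : ∀ {a b c} → Conn S a b → Conn S b c → Conn S a c

Conn-elim : ∀ {n} {S : List (Edge n)} (R : Fin n → Fin n → Set) →
            (∀ {a} → R a a) → (∀ {a b} → R a b → R b a) → (∀ {a b c} → R a b → R b c → R a c) →
            (∀ {a b} → (a , b) ∈ S → R a b) → ∀ {x y} → Conn S x y → R x y
Conn-elim R r s t e (conn-edge ab)   = e ab
Conn-elim R r s t e conn-refl        = r
Conn-elim R r s t e (conn-sym c)     = s (Conn-elim R r s t e c)
Conn-elim R r s t e (conn-trans c d) = t (Conn-elim R r s t e c) (Conn-elim R r s t e d)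

Conn-map : ∀ {n m} {S : List (Edge n)} {T : List (Edge m)} (f : Fin n → Fin m) →
           (∀ {a b} → (a , b) ∈ S → Conn T (f a) (f b)) → ∀ {x y} → Conn S x y → Conn T (f x) (f y)
Conn-map f = Conn-elim (λ x y → Conn _ (f x) (f y)) conn-refl conn-sym conn-trans

Conn-mono : ∀ {n} {S T : List (Edge n)} → (∀ {a b} → (a , b) ∈ S → Conn T a b) → ∀ {x y} → Conn S x y → Conn T x y
Conn-mono = Conn-map id

anyB-map⇒∃ : ∀ {A : Set} (f : A → Bool) (xs : List A) → anyB (map f xs) ≡ true → ∃ λ x → x ∈ xs × f x ≡ true
anyB-map⇒∃ f (x ∷ xs) e with ∨≡true⇒ {f x} e
... | inj₁ fx = x , here refl , fx
... | inj₂ rest with anyB-map⇒∃ f xs rest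
...   | y , y∈xs , fy = y , there y∈xs , fy

∈⇒anyB-map : ∀ {A : Set} (f : A → Bool) {xs : List A} {x} → x ∈ xs → f x ≡ true → anyB (map f xs) ≡ true
∈⇒anyB-map f           (here refl) e rewrite e = refl
∈⇒anyB-map f {y ∷ xs} (there x∈xs) e = ∨-trueʳ (f y) (∈⇒anyB-map f x∈xs e)

module Reachability {n} (S : List (Edge n)) (x : Fin n) where

  reached : ℕ → Fin n → Bool
  reached k = iter k (step S) (_== x)

  reached⇒Conn : ∀ k y → reached k y ≡ true → Conn S x y
  reached⇒Conn zero    y e = subst (Conn S x) (sym (==⇒≡ e)) conn-refl
  reached⇒Conn (suc k) y e with ∨≡true⇒ {reached k y} e
  ... | inj₁ old = reached⇒Conn k y old
  ... | inj₂ new with anyB-map⇒∃ _ S new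
  ...   | (a , b) , ab∈S , via with ∨≡true⇒ {reached k a ∧ (b == y)} via
  ...     | inj₁ via-a = let (ra , b≡y) = ∧≡true⇒ via-a in
                         conn-trans (reached⇒Conn k a ra) (subst (Conn S a) (==⇒≡ b≡y) (conn-edge ab∈S))
  ...     | inj₂ via-b = let (rb , a≡y) = ∧≡true⇒ via-b in
                         conn-trans (reached⇒Conn k b rb) (subst (Conn S b) (==⇒≡ a≡y) (conn-sym (conn-edge ab∈S)))

  step-extensive : ∀ (Q : Fin n → Bool) w → Q w ≡ true → step S Q w ≡ true
  step-extensive Q w e rewrite e = refl

  reached-source : ∀ k → reached k x ≡ true
  reached-source zero    = ==-refl x
  reached-source (suc k) = step-extensive (reached k) x (reached-source k)

  Stable : (Fin n → Bool) → Set
  Stable Q = ∀ w → step S Q w ≡ Q w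

  step-cong : ∀ {Q Q′ : Fin n → Bool} → (∀ w → Q w ≡ Q′ w) → ∀ w → step S Q w ≡ step S Q′ w
  step-cong {Q} {Q′} Q≗Q′ w = cong₂ _∨_ (Q≗Q′ w) (cong anyB (ListP.map-cong via S))
    where
    via : ∀ (e : Edge n) → ((Q (proj₁ e) ∧ (proj₂ e == w)) ∨ (Q (proj₂ e) ∧ (proj₁ e == w)))
                         ≡ ((Q′ (proj₁ e) ∧ (proj₂ e == w)) ∨ (Q′ (proj₂ e) ∧ (proj₁ e == w)))
    via (a , b) rewrite Q≗Q′ a | Q≗Q′ b = refl

  size : (Fin n → Bool) → ℕ
  size Q = sum (⟦_⟧ ∘ Q)

  size-grows : ∀ k w → step S (reached k) w ≢ reached k w → size (reached k) < size (reached (suc k))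
  size-grows k w changed =
    sum-mono-< (λ i → ⟦⟧-mono (step-extensive (reached k) i)) w (⟦⟧-mono-< (step-extensive (reached k) w) changed)
    where
    ⟦⟧-mono : ∀ {a b} → (a ≡ true → b ≡ true) → ⟦ a ⟧ ≤ ⟦ b ⟧
    ⟦⟧-mono {false} _ = z≤n
    ⟦⟧-mono {true}  f rewrite f refl = s≤s z≤n
    ⟦⟧-mono-< : ∀ {a b} → (a ≡ true → b ≡ true) → b ≢ a → ⟦ a ⟧ < ⟦ b ⟧
    ⟦⟧-mono-< {false} {false} _ b≢a = ⊥-elim (b≢a refl)
    ⟦⟧-mono-< {false} {true}  _ _   = s≤s z≤n
    ⟦⟧-mono-< {true}          f b≢a = ⊥-elim (b≢a (f refl))

  stable? : ∀ Q → Stable Q ⊎ ∃ λ w → step S Q w ≢ Q w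
  stable? Q with FinP.all? (λ w → step S Q w BoolP.≟ Q w)
  ... | yes stable = inj₁ stable
  ... | no ¬stable = inj₂ (FinP.¬∀⟶∃¬ n _ (λ w → step S Q w BoolP.≟ Q w) ¬stable)

  stable-or-large : ∀ k → Stable (reached k) ⊎ suc k ≤ size (reached k)
  stable-or-large zero = inj₂ (ℕP.≤-trans (ℕP.≤-reflexive (cong ⟦_⟧ (sym (reached-source 0))))
                                          (sum-≥-term (⟦_⟧ ∘ reached 0) x))
  stable-or-large (suc k) with stable-or-large k | stable? (reached k)
  ... | _          | inj₁ stable = inj₁ λ w → trans (step-cong stable w) (trans (stable w) (sym (stable w)))
  ... | inj₁ stable | inj₂ _     = inj₁ λ w → trans (step-cong stable w) (trans (stable w) (sym (stable w)))
  ... | inj₂ large | inj₂ (w , changed) = inj₂ (ℕP.<-≤-trans (s≤s large) (size-grows k w changed))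

  -- A strictly growing subset of Fin n stabilises within n steps.
  reached-stable : Stable (reached n)
  reached-stable with stable-or-large n
  ... | inj₁ stable = stable
  ... | inj₂ large  = ⊥-elim (ℕP.<-irrefl refl (ℕP.≤-trans large (sum-⟦⟧≤ (reached n))))

  Conn⇒reached-closed : ∀ {a b} → Conn S a b → (reached n a ≡ true → reached n b ≡ true) × (reached n b ≡ true → reached n a ≡ true)
  Conn⇒reached-closed =
    Conn-elim (λ a b → (reached n a ≡ true → reached n b ≡ true) × (reached n b ≡ true → reached n a ≡ true))
              (id , id) (λ (f , g) → g , f) (λ (f , g) (f′ , g′) → f′ ∘ f , g ∘ g′)
              (λ {a} {b} ab∈S → (λ ra → trans (sym (reached-stable b)) (∨-trueʳ (reached n b) (∈⇒anyB-map _ ab∈S (forward ra b))))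
                              , (λ rb → trans (sym (reached-stable a)) (∨-trueʳ (reached n a) (∈⇒anyB-map _ ab∈S (backward rb a)))))
    where
    forward : ∀ {a} → reached n a ≡ true → ∀ b → ((reached n a ∧ (b == b)) ∨ (reached n b ∧ (a == b))) ≡ true
    forward ra b rewrite ra | ==-refl b = refl
    backward : ∀ {b} → reached n b ≡ true → ∀ a → ((reached n a ∧ (b == a)) ∨ (reached n b ∧ (a == a))) ≡ true
    backward rb a rewrite rb | ==-refl a = BoolP.∨-zeroʳ _

reach⇒Conn : ∀ {n} (S : List (Edge n)) x y → reach S x y ≡ true → Conn S x y
reach⇒Conn {n} S x y = Reachability.reached⇒Conn S x n y

Conn⇒reach : ∀ {n} (S : List (Edge n)) x y → Conn S x y → reach S x y ≡ true
Conn⇒reach {n} S x y c = proj₁ (Reachability.Conn⇒reached-closed S x c) (Reachability.reached-source S x n)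

reach-cong : ∀ {n m} (S : List (Edge n)) (T : List (Edge m)) x y x′ y′ →
             (Conn S x y → Conn T x′ y′) → (Conn T x′ y′ → Conn S x y) → reach S x y ≡ reach T x′ y′
reach-cong S T x y x′ y′ f g = bool-ext (λ e → Conn⇒reach T x′ y′ (f (reach⇒Conn S x y e)))
                                        (λ e → Conn⇒reach S x y (g (reach⇒Conn T x′ y′ e)))

-- Counting the classes of a Boolean equivalence relation on Fin n

BoolRel : ℕ → Set
BoolRel n = Fin n → Fin n → Bool

before : ∀ {n} → Fin n → Fin n → Bool
before w′ w = ⌊ toℕ w′ ℕ.<? toℕ w ⌋

-- A class is counted at its least element, so components S is classCount (reach S).
classCount : ∀ {n} → BoolRel n → ℕ
classCount {n} r = count (map (λ w → not (anyB (map (λ w′ → ⌊ Fin.toℕ w′ ℕ.<? Fin.toℕ w ⌋ ∧ r w w′) (allFin n)))) (allFin n))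

isLeast : ∀ {n} → BoolRel n → Fin n → Bool
isLeast r w = not (anyF (λ w′ → before w′ w ∧ r w w′))

classCount-sum : ∀ {n} (r : BoolRel n) → classCount r ≡ sum (λ w → ⟦ isLeast r w ⟧)
classCount-sum {n} r =
  trans (count-allFin (λ w → not (anyB (map (λ w′ → before w′ w ∧ r w w′) (allFin n)))))
        (sum-cong-≗ (λ w → cong (λ b → ⟦ not b ⟧) (anyB-allFin (λ w′ → before w′ w ∧ r w w′))))

Least : ∀ {n} → BoolRel n → Fin n → Set
Least r w = ∀ w′ → toℕ w′ < toℕ w → r w w′ ≡ false

isLeast⇒Least : ∀ {n} (r : BoolRel n) w → isLeast r w ≡ true → Least r w
isLeast⇒Least r w least w′ w′<w with r w w′ in rww′
... | false = refl
... | true  = ⊥-elim (false≢true (trans (sym (not≡true⇒ least)) (∃⇒anyF _ w′ earlier)))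
  where
  earlier : (before w′ w ∧ r w w′) ≡ true
  earlier rewrite ⌊⌋-true (toℕ w′ ℕ.<? toℕ w) w′<w | rww′ = refl

Least⇒isLeast : ∀ {n} (r : BoolRel n) w → Least r w → isLeast r w ≡ true
Least⇒isLeast r w least = cong not (anyF-false _ none-earlier)
  where
  none-earlier : ∀ w′ → (before w′ w ∧ r w w′) ≡ false
  none-earlier w′ with toℕ w′ ℕ.<? toℕ w
  ... | yes w′<w = least w′ w′<w
  ... | no _     = refl

¬isLeast⇒ : ∀ {n} (r : BoolRel n) w → isLeast r w ≡ false → ∃ λ w′ → toℕ w′ < toℕ w × r w w′ ≡ true
¬isLeast⇒ r w ¬least with anyF⇒∃ _ (not≡false⇒ ¬least)
... | w′ , earlier = let (w′<w , rww′) = ∧≡true⇒ earlier in w′ , ⌊⌋≡true⇒ (toℕ w′ ℕ.<? toℕ w) w′<w , rww′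

classCount-cong : ∀ {n} (r r′ : BoolRel n) → (∀ i j → r i j ≡ r′ i j) → classCount r ≡ classCount r′
classCount-cong r r′ r≗r′ =
  trans (classCount-sum r)
        (trans (sum-cong-≗ (λ w → cong (λ b → ⟦ not b ⟧) (anyF-cong λ w′ → cong (before w′ w ∧_) (r≗r′ w w′))))
               (sym (classCount-sum r′)))

record IsEquivalenceᵇ {n} (r : BoolRel n) : Set where
  field
    r-refl  : ∀ a → r a a ≡ true
    r-sym   : ∀ {a b} → r a b ≡ true → r b a ≡ true
    r-trans : ∀ {a b c} → r a b ≡ true → r b c ≡ true → r a c ≡ true

isSingleton : ∀ {n} → BoolRel n → Fin n → Bool
isSingleton r y = not (anyF (λ z → not (z == y) ∧ r y z))

isSingleton⇒ : ∀ {n} (r : BoolRel n) y → isSingleton r y ≡ true → ∀ z → r y z ≡ true → z ≡ y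
isSingleton⇒ r y single z ryz with z FinP.≟ y
... | yes z≡y = z≡y
... | no z≢y  = ⊥-elim (false≢true (trans (sym (not≡true⇒ single)) (∃⇒anyF _ z other)))
  where
  other : (not (z == y) ∧ r y z) ≡ true
  other rewrite ≢⇒==false z≢y | ryz = refl

¬isSingleton⇒ : ∀ {n} (r : BoolRel n) y → isSingleton r y ≡ false → ∃ λ z → z ≢ y × r y z ≡ true
¬isSingleton⇒ r y ¬single with anyF⇒∃ _ (not≡false⇒ ¬single)
... | z , other = let (z≠y , ryz) = ∧≡true⇒ other in
                  z , (λ z≡y → false≢true (trans (sym (cong not (≡⇒== z≡y))) z≠y)) , ryz

⇒isSingleton : ∀ {n} (r : BoolRel n) y → (∀ z → r y z ≡ true → z ≡ y) → isSingleton r y ≡ true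
⇒isSingleton r y only = cong not (anyF-false _ no-other)
  where
  no-other : ∀ z → (not (z == y) ∧ r y z) ≡ false
  no-other z with r y z in ryz
  ... | false = BoolP.∧-zeroʳ _
  ... | true rewrite only z ryz | ==-refl y = refl

least-witness : ∀ {n} (P : Fin n → Bool) → ∃ (λ i → P i ≡ true) → ∃ λ i → P i ≡ true × (∀ j → toℕ j < toℕ i → P j ≡ false)
least-witness {suc n} P (i , Pi) with P zero in P0
... | true  = zero , P0 , λ j ()
... | false with i
...   | zero   = ⊥-elim (false≢true (trans (sym P0) Pi))
...   | suc i′ with least-witness (P ∘ suc) (i′ , Pi)
...     | k , Pk , below-k = suc k , Pk , below
  where
  below : ∀ j → toℕ j < toℕ (suc k) → P j ≡ false
  below zero    _          = P0
  below (suc j) (s≤s j<k)  = below-k j j<k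

punchIn-< : ∀ {n} (y : Fin (suc n)) (i j : Fin n) → toℕ j < toℕ i → toℕ (punchIn y j) < toℕ (punchIn y i)
punchIn-< y i j j<i = ℕP.≰⇒> (λ le → ℕP.<⇒≱ j<i (FinP.punchIn-cancel-≤ y i j le))

punchIn-<⁻ : ∀ {n} (y : Fin (suc n)) (i j : Fin n) → toℕ (punchIn y j) < toℕ (punchIn y i) → toℕ j < toℕ i
punchIn-<⁻ y i j j<i = ℕP.≰⇒> (λ le → ℕP.<⇒≱ j<i (FinP.punchIn-mono-≤ y i j le))

⟦⟧-split : ∀ a b → (a ≡ true → b ≡ true) → ⟦ b ⟧ ≡ ⟦ a ⟧ + ⟦ b ∧ not a ⟧
⟦⟧-split false false _ = refl
⟦⟧-split false true  _ = refl
⟦⟧-split true  b     a⇒b rewrite a⇒b refl = refl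

-- Deleting y changes least elements only in the class of y: its least other
-- member becomes least exactly when y was least there and not alone.
module Removal {n} (r : BoolRel (suc n)) (E : IsEquivalenceᵇ r) (y : Fin (suc n)) where
  open IsEquivalenceᵇ E

  r∖y : BoolRel n
  r∖y i j = r (punchIn y i) (punchIn y j)

  Least-punchIn : ∀ i → Least r (punchIn y i) → Least r∖y i
  Least-punchIn i least j j<i = least (punchIn y j) (punchIn-< y i j j<i)

  newLeast : Fin n → Bool
  newLeast i = isLeast r∖y i ∧ not (isLeast r (punchIn y i))

  -- The earlier member of its class witnessing ¬ isLeast must be y itself.
  newLeast⇒ : ∀ i → newLeast i ≡ true → Least r∖y i × toℕ y < toℕ (punchIn y i) × r (punchIn y i) y ≡ true
  newLeast⇒ i new with ∧≡true⇒ {isLeast r∖y i} new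
  ... | least∖ , ¬least with ¬isLeast⇒ r (punchIn y i) (not≡true⇒ ¬least)
  ...   | w′ , w′<i , rw′ with w′ FinP.≟ y
  ...     | yes refl = isLeast⇒Least r∖y i least∖ , w′<i , rw′
  ...     | no w′≢y  = ⊥-elim (false≢true (trans (sym (isLeast⇒Least r∖y i least∖ j (punchIn-<⁻ y i j j<i))) rij))
    where
    j = punchOut (w′≢y ∘ sym)
    j≡ : punchIn y j ≡ w′
    j≡ = FinP.punchIn-punchOut (w′≢y ∘ sym)
    j<i : toℕ (punchIn y j) < toℕ (punchIn y i)
    j<i = subst (λ z → toℕ z < toℕ (punchIn y i)) (sym j≡) w′<i
    rij : r∖y i j ≡ true
    rij = subst (λ z → r (punchIn y i) z ≡ true) (sym j≡) rw′

  newLeast⇒Least-y : ∀ i → newLeast i ≡ true → Least r y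
  newLeast⇒Least-y i new z z<y with r y z in ryz
  ... | false = refl
  ... | true  = ⊥-elim (false≢true (trans (sym (least∖ j (punchIn-<⁻ y i j j<i))) rij))
    where
    least∖ = proj₁ (newLeast⇒ i new)
    z≢y : z ≢ y
    z≢y z≡y = ℕP.<-irrefl (cong toℕ z≡y) z<y
    j = punchOut (z≢y ∘ sym)
    j≡ : punchIn y j ≡ z
    j≡ = FinP.punchIn-punchOut (z≢y ∘ sym)
    j<i : toℕ (punchIn y j) < toℕ (punchIn y i)
    j<i = subst (λ q → toℕ q < toℕ (punchIn y i)) (sym j≡) (ℕP.<-trans z<y (proj₁ (proj₂ (newLeast⇒ i new))))
    rij : r∖y i j ≡ true
    rij = subst (λ q → r (punchIn y i) q ≡ true) (sym j≡) (r-trans (proj₂ (proj₂ (newLeast⇒ i new))) ryz)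

  newLeast⇒¬isSingleton : ∀ i → newLeast i ≡ true → isSingleton r y ≡ false
  newLeast⇒¬isSingleton i new =
    ≢true⇒ λ single → FinP.punchInᵢ≢i y i (isSingleton⇒ r y single _ (r-sym (proj₂ (proj₂ (newLeast⇒ i new)))))

  newLeast-related : ∀ a b → newLeast a ≡ true → newLeast b ≡ true → r∖y a b ≡ true
  newLeast-related a b new-a new-b = r-trans (proj₂ (proj₂ (newLeast⇒ a new-a))) (r-sym (proj₂ (proj₂ (newLeast⇒ b new-b))))

  newLeast-unique : ∀ i j → newLeast i ≡ true → newLeast j ≡ true → i ≡ j
  newLeast-unique i j new-i new-j with FinP.<-cmp i j
  ... | tri≈ _ i≡j _ = i≡j
  ... | tri< i<j _ _ = ⊥-elim (false≢true (trans (sym (proj₁ (newLeast⇒ j new-j) i i<j)) (newLeast-related j i new-j new-i)))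
  ... | tri> _ _ j<i = ⊥-elim (false≢true (trans (sym (proj₁ (newLeast⇒ i new-i) j j<i)) (newLeast-related i j new-i new-j)))

  isSingleton⇒Least : isSingleton r y ≡ true → Least r y
  isSingleton⇒Least single z z<y with r y z in ryz
  ... | false = refl
  ... | true  = ⊥-elim (ℕP.<-irrefl (cong toℕ (isSingleton⇒ r y single z ryz)) z<y)

  newLeast-exists : Least r y → isSingleton r y ≡ false → ∃ λ i → newLeast i ≡ true
  newLeast-exists least-y ¬single
    with least-witness (λ z → not (z == y) ∧ r y z) (let (z , z≢y , ryz) = ¬isSingleton⇒ r y ¬single in z , other z≢y ryz)
    where
    other : ∀ {z} → z ≢ y → r y z ≡ true → (not (z == y) ∧ r y z) ≡ true
    other z≢y ryz rewrite ≢⇒==false z≢y | ryz = refl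
  ... | z , other-z , below-z = i , new-i
    where
    z≠y,ryz = ∧≡true⇒ {not (z == y)} other-z
    z≢y : z ≢ y
    z≢y z≡y = false≢true (trans (sym (cong not (≡⇒== z≡y))) (proj₁ z≠y,ryz))
    ryz = proj₂ z≠y,ryz
    y<z : toℕ y < toℕ z
    y<z with ℕP.<-cmp (toℕ y) (toℕ z)
    ... | tri< y<z _ _   = y<z
    ... | tri≈ _ y≡z _   = ⊥-elim (z≢y (sym (FinP.toℕ-injective y≡z)))
    ... | tri> _ _ z<y   = ⊥-elim (false≢true (trans (sym (least-y z z<y)) ryz))
    i = punchOut (z≢y ∘ sym)
    i≡ : punchIn y i ≡ z
    i≡ = FinP.punchIn-punchOut (z≢y ∘ sym)
    least∖ : Least r∖y i
    least∖ j j<i with r∖y i j in rij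
    ... | false = refl
    ... | true  = ⊥-elim (false≢true (trans (sym (below-z (punchIn y j) j<z)) other-j))
      where
      j<z : toℕ (punchIn y j) < toℕ z
      j<z = subst (λ q → toℕ (punchIn y j) < toℕ q) i≡ (punchIn-< y i j j<i)
      ryj : r y (punchIn y j) ≡ true
      ryj = r-trans ryz (subst (λ q → r q (punchIn y j) ≡ true) i≡ rij)
      other-j : (not (punchIn y j == y) ∧ r y (punchIn y j)) ≡ true
      other-j rewrite ≢⇒==false (FinP.punchInᵢ≢i y j) | ryj = refl
    ¬least : isLeast r (punchIn y i) ≡ false
    ¬least = ≢true⇒ λ least → false≢true (trans (sym (isLeast⇒Least r (punchIn y i) least y (subst (λ q → toℕ y < toℕ q) (sym i≡) y<z)))
                                                (subst (λ q → r q y ≡ true) (sym i≡) (r-sym ryz)))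
    new-i : newLeast i ≡ true
    new-i rewrite Least⇒isLeast r∖y i least∖ | ¬least = refl

  sum-newLeast : sum (⟦_⟧ ∘ newLeast) + ⟦ isSingleton r y ⟧ ≡ ⟦ isLeast r y ⟧
  sum-newLeast = by-cases (isLeast r y) (isSingleton r y) refl refl
    where
    by-cases : ∀ a b → isLeast r y ≡ a → isSingleton r y ≡ b → sum (⟦_⟧ ∘ newLeast) + ⟦ b ⟧ ≡ ⟦ a ⟧
    by-cases false true  ¬least single = ⊥-elim (false≢true (trans (sym ¬least) (Least⇒isLeast r y (isSingleton⇒Least single))))
    by-cases false false ¬least _      = cong (_+ 0) (sum-⟦⟧-zero newLeast λ i → ≢true⇒ λ new →
                                           false≢true (trans (sym ¬least) (Least⇒isLeast r y (newLeast⇒Least-y i new))))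
    by-cases true  true  _      single = cong (_+ 1) (sum-⟦⟧-zero newLeast λ i → ≢true⇒ λ new →
                                           false≢true (trans (sym (newLeast⇒¬isSingleton i new)) single))
    by-cases true  false least  ¬single = cong (_+ 0) (sum-⟦⟧-one newLeast i new-i (λ j new-j → newLeast-unique j i new-j new-i))
      where
      i     = proj₁ (newLeast-exists (isLeast⇒Least r y least) ¬single)
      new-i = proj₂ (newLeast-exists (isLeast⇒Least r y least) ¬single)

  isLeast-∖ : ∀ i → ⟦ isLeast r∖y i ⟧ ≡ ⟦ isLeast r (punchIn y i) ⟧ + ⟦ newLeast i ⟧
  isLeast-∖ i = ⟦⟧-split (isLeast r (punchIn y i)) (isLeast r∖y i)
                         (λ least → Least⇒isLeast r∖y i (Least-punchIn i (isLeast⇒Least r (punchIn y i) least)))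

  classCount-remove : classCount r ≡ classCount r∖y + ⟦ isSingleton r y ⟧
  classCount-remove = begin
    classCount r                                    ≡⟨ classCount-sum r ⟩
    sum least                                       ≡⟨ sum-remove {i = y} least ⟩
    least y + sum (least ∘ punchIn y)               ≡⟨ cong (_+ sum (least ∘ punchIn y)) sum-newLeast ⟨
    sum (⟦_⟧ ∘ newLeast) + ⟦ isSingleton r y ⟧ + sum (least ∘ punchIn y)
      ≡⟨ rearrange (sum (⟦_⟧ ∘ newLeast)) ⟦ isSingleton r y ⟧ (sum (least ∘ punchIn y)) ⟩
    sum (least ∘ punchIn y) + sum (⟦_⟧ ∘ newLeast) + ⟦ isSingleton r y ⟧
      ≡⟨ cong (_+ ⟦ isSingleton r y ⟧) (∑-distrib-+ (least ∘ punchIn y) (⟦_⟧ ∘ newLeast)) ⟨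
    sum (λ i → least (punchIn y i) + ⟦ newLeast i ⟧) + ⟦ isSingleton r y ⟧
      ≡⟨ cong (_+ ⟦ isSingleton r y ⟧) (sum-cong-≗ isLeast-∖) ⟨
    sum (λ i → ⟦ isLeast r∖y i ⟧) + ⟦ isSingleton r y ⟧ ≡⟨ cong (_+ ⟦ isSingleton r y ⟧) (classCount-sum r∖y) ⟨
    classCount r∖y + ⟦ isSingleton r y ⟧            ∎
    where
    open ≡-Reasoning
    least : Fin (suc n) → ℕ
    least w = ⟦ isLeast r w ⟧
    rearrange : ∀ a b c → a + b + c ≡ c + a + b
    rearrange = ℕ-Solver.solve-∀

IsEquivalenceᵇ-∖ : ∀ {n} (r : BoolRel (suc n)) → (E : IsEquivalenceᵇ r) → (y : Fin (suc n)) → IsEquivalenceᵇ (Removal.r∖y r E y)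
IsEquivalenceᵇ-∖ r E y = record { r-refl = λ a → r-refl (punchIn y a) ; r-sym = r-sym ; r-trans = r-trans }
  where open IsEquivalenceᵇ E

classCount-merge : ∀ {n} (r : BoolRel (suc n)) → IsEquivalenceᵇ r → (y z : Fin (suc n)) → z ≢ y → r y z ≡ true →
                   (r′ : BoolRel n) → (∀ i j → r′ i j ≡ r (punchIn y i) (punchIn y j)) → classCount r ≡ classCount r′
classCount-merge r E y z z≢y ryz r′ r′≡ = begin
  classCount r                                         ≡⟨ Removal.classCount-remove r E y ⟩
  classCount (Removal.r∖y r E y) + ⟦ isSingleton r y ⟧ ≡⟨ cong (λ b → classCount (Removal.r∖y r E y) + ⟦ b ⟧) ¬single ⟩
  classCount (Removal.r∖y r E y) + 0                   ≡⟨ ℕP.+-identityʳ _ ⟩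
  classCount (Removal.r∖y r E y)                       ≡⟨ classCount-cong _ _ (λ i j → sym (r′≡ i j)) ⟩
  classCount r′                                        ∎
  where
  open ≡-Reasoning
  ¬single : isSingleton r y ≡ false
  ¬single = ≢true⇒ λ single → z≢y (isSingleton⇒ r y single z ryz)

classCount-permute : ∀ {n m} (π : Permutation n m) (r : BoolRel n) (r′ : BoolRel m) → IsEquivalenceᵇ r → IsEquivalenceᵇ r′ →
                     (∀ x y → r′ (π ⟨$⟩ʳ x) (π ⟨$⟩ʳ y) ≡ r x y) → classCount r ≡ classCount r′
classCount-permute {zero}  {zero}  π r r′ E E′ r′π≡r = refl
classCount-permute {zero}  {suc m} π r r′ E E′ r′π≡r with π ⟨$⟩ˡ zero
... | ()
classCount-permute {suc n} {zero}  π r r′ E E′ r′π≡r with π ⟨$⟩ʳ zero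
... | ()
classCount-permute {suc n} {suc m} π r r′ E E′ r′π≡r = begin
  classCount r                                            ≡⟨ Removal.classCount-remove r E zero ⟩
  classCount (Removal.r∖y r E zero) + ⟦ isSingleton r zero ⟧ ≡⟨ cong₂ (λ c b → c + ⟦ b ⟧) rest singletons ⟩
  classCount (Removal.r∖y r′ E′ π₀) + ⟦ isSingleton r′ π₀ ⟧ ≡⟨ Removal.classCount-remove r′ E′ π₀ ⟨
  classCount r′                                           ∎
  where
  open ≡-Reasoning
  π₀ = π ⟨$⟩ʳ zero
  rest : classCount (Removal.r∖y r E zero) ≡ classCount (Removal.r∖y r′ E′ π₀)
  rest = classCount-permute (Perm.remove zero π) (Removal.r∖y r E zero) (Removal.r∖y r′ E′ π₀)
                            (IsEquivalenceᵇ-∖ r E zero) (IsEquivalenceᵇ-∖ r′ E′ π₀)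
           λ j k → trans (sym (cong₂ r′ (Perm.punchIn-permute π zero j) (Perm.punchIn-permute π zero k))) (r′π≡r _ _)
  singletons : isSingleton r zero ≡ isSingleton r′ π₀
  singletons = bool-ext to from
    where
    to : isSingleton r zero ≡ true → isSingleton r′ π₀ ≡ true
    to single = ⇒isSingleton r′ π₀ λ z′ r′π₀z′ →
      trans (sym (Perm.inverseʳ π))
            (cong (π ⟨$⟩ʳ_) (isSingleton⇒ r zero single (π ⟨$⟩ˡ z′)
                              (trans (sym (r′π≡r zero (π ⟨$⟩ˡ z′))) (subst (λ t → r′ π₀ t ≡ true) (sym (Perm.inverseʳ π)) r′π₀z′))))
    from : isSingleton r′ π₀ ≡ true → isSingleton r zero ≡ true
    from single = ⇒isSingleton r zero λ z r0z →
      trans (sym (Perm.inverseˡ π))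
            (trans (cong (π ⟨$⟩ˡ_) (isSingleton⇒ r′ π₀ single (π ⟨$⟩ʳ z) (trans (r′π≡r zero z) r0z))) (Perm.inverseˡ π))

classCount-↑ : ∀ n m (r : BoolRel (n + m)) (r₁ : BoolRel n) (r₂ : BoolRel m) →
               (∀ i j → r (i ↑ˡ m) (j ↑ˡ m) ≡ r₁ i j) → (∀ i j → r (n ↑ʳ i) (n ↑ʳ j) ≡ r₂ i j) →
               (∀ i j → r (i ↑ˡ m) (n ↑ʳ j) ≡ false) → (∀ i j → r (n ↑ʳ j) (i ↑ˡ m) ≡ false) →
               classCount r ≡ classCount r₁ + classCount r₂
classCount-↑ n m r r₁ r₂ left right ¬left-right ¬right-left = begin
  classCount r                                                            ≡⟨ classCount-sum r ⟩
  sum (λ w → ⟦ isLeast r w ⟧)                                             ≡⟨ sum-↑ n m _ ⟩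
  sum (λ i → ⟦ isLeast r (i ↑ˡ m) ⟧) + sum (λ j → ⟦ isLeast r (n ↑ʳ j) ⟧)
    ≡⟨ cong₂ _+_ (sum-cong-≗ (λ i → cong ⟦_⟧ (isLeast-left i))) (sum-cong-≗ (λ j → cong ⟦_⟧ (isLeast-right j))) ⟩
  sum (λ i → ⟦ isLeast r₁ i ⟧) + sum (λ j → ⟦ isLeast r₂ j ⟧)             ≡⟨ cong₂ _+_ (classCount-sum r₁) (classCount-sum r₂) ⟨
  classCount r₁ + classCount r₂                                           ∎
  where
  open ≡-Reasoning
  before-↑ˡ : ∀ i j → before (j ↑ˡ m) (i ↑ˡ m) ≡ before j i
  before-↑ˡ i j = ⌊⌋-cong (subst₂ ℕ._<_ (FinP.toℕ-↑ˡ j m) (FinP.toℕ-↑ˡ i m)) (subst₂ ℕ._<_ (sym (FinP.toℕ-↑ˡ j m)) (sym (FinP.toℕ-↑ˡ i m)))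
                          (toℕ (j ↑ˡ m) ℕ.<? toℕ (i ↑ˡ m)) (toℕ j ℕ.<? toℕ i)
  before-↑ʳ : ∀ j k → before (n ↑ʳ k) (n ↑ʳ j) ≡ before k j
  before-↑ʳ j k = ⌊⌋-cong (λ lt → ℕP.+-cancelˡ-< n _ _ (subst₂ ℕ._<_ (FinP.toℕ-↑ʳ n k) (FinP.toℕ-↑ʳ n j) lt))
                          (λ lt → subst₂ ℕ._<_ (sym (FinP.toℕ-↑ʳ n k)) (sym (FinP.toℕ-↑ʳ n j)) (ℕP.+-monoʳ-< n lt))
                          (toℕ (n ↑ʳ k) ℕ.<? toℕ (n ↑ʳ j)) (toℕ k ℕ.<? toℕ j)
  isLeast-left : ∀ i → isLeast r (i ↑ˡ m) ≡ isLeast r₁ i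
  isLeast-left i = cong not (trans (anyF-↑ n m _)
    (trans (cong₂ _∨_ (anyF-cong λ j → cong₂ _∧_ (before-↑ˡ i j) (left i j))
                      (anyF-false _ λ j → trans (cong (before (n ↑ʳ j) (i ↑ˡ m) ∧_) (¬left-right i j)) (BoolP.∧-zeroʳ _)))
           (BoolP.∨-identityʳ _)))
  isLeast-right : ∀ j → isLeast r (n ↑ʳ j) ≡ isLeast r₂ j
  isLeast-right j = cong not (trans (anyF-↑ n m _)
    (cong₂ _∨_ (anyF-false _ λ i → trans (cong (before (i ↑ˡ m) (n ↑ʳ j) ∧_) (¬right-left i j)) (BoolP.∧-zeroʳ _))
               (anyF-cong λ k → cong₂ _∧_ (before-↑ʳ j k) (right j k))))

mergeMap : ∀ {n} (u v : Fin (suc n)) → u ≢ v → Fin (suc n) → Fin n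
mergeMap u v u≢v w with w FinP.≟ v
... | yes _   = punchOut {i = v} {j = u} (u≢v ∘ sym)
... | no w≢v  = punchOut {i = v} {j = w} (w≢v ∘ sym)

-- The vertex maps used by `contract` and `deleteVertex` are local to their
-- where-blocks; they are extracted as the first component of a Σ and then
-- identified with the named maps mergeMap and avoiding.
contract-map : ∀ {n} (es : List (Edge (suc n))) (e : Fin (length es)) (u≢v : proj₁ (lookup es e) ≢ proj₂ (lookup es e)) →
               Σ (Fin (suc n) → Fin n) λ φ → edges (contract es e u≢v) ≡ map (mapEdge φ) (removeAt es e)
contract-map es e u≢v = _ , refl

contract-edges : ∀ {n} (es : List (Edge (suc n))) (e : Fin (length es)) (u≢v : proj₁ (lookup es e) ≢ proj₂ (lookup es e)) →
                 edges (contract es e u≢v) ≡ map (mapEdge (mergeMap _ _ u≢v)) (removeAt es e)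
contract-edges es e u≢v =
  trans (proj₂ (contract-map es e u≢v)) (ListP.map-cong (λ (a , b) → cong₂ _,_ (φ≗merge a) (φ≗merge b)) (removeAt es e))
  where
  φ≗merge : ∀ w → proj₁ (contract-map es e u≢v) w ≡ mergeMap _ _ u≢v w
  φ≗merge w with w FinP.≟ proj₂ (lookup es e)
  ... | yes _ = refl
  ... | no _  = refl

avoiding : ∀ {n} (u : Fin (suc n)) → Edge (suc n) → Maybe (Edge n)
avoiding u (a , b) with u FinP.≟ a | u FinP.≟ b
... | no u≢a | no u≢b = just (punchOut u≢a , punchOut u≢b)
... | _      | _      = nothing

deleteVertex-map : ∀ {n} (es : List (Edge (suc n))) u →
                   Σ (Edge (suc n) → Maybe (Edge n)) λ keep → edges (deleteVertex es u) ≡ mapMaybe keep es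
deleteVertex-map es u = _ , refl

deleteVertex-edges : ∀ {n} (es : List (Edge (suc n))) u → edges (deleteVertex es u) ≡ mapMaybe (avoiding u) es
deleteVertex-edges es u = trans (proj₂ (deleteVertex-map es u)) (ListP.mapMaybe-cong keep≗avoiding es)
  where
  keep≗avoiding : ∀ x → proj₁ (deleteVertex-map es u) x ≡ avoiding u x
  keep≗avoiding (a , b) with u FinP.≟ a | u FinP.≟ b
  ... | yes _ | yes _ = refl
  ... | yes _ | no _  = refl
  ... | no _  | yes _ = refl
  ... | no _  | no _  = refl

edgeDegree : ∀ {n} → Edge n → Fin n → ℕ
edgeDegree (a , b) w = ⟦ a == w ⟧ + ⟦ b == w ⟧

degree-∷ : ∀ {n} (e : Edge n) S w → degree (e ∷ S) w ≡ edgeDegree e w + degree S w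
degree-∷ (a , b) S w =
  cong (_+ degree S w) (trans (count-∷ (a == w) _) (cong (⟦ a == w ⟧ +_) (trans (count-∷ (b == w) []) (ℕP.+-identityʳ _))))

degree-↭ : ∀ {n} {S S′ : List (Edge n)} → S ↭ S′ → ∀ w → degree S w ≡ degree S′ w
degree-↭ ↭.refl w = refl
degree-↭ {S = _ ∷ xs} {_ ∷ ys} (prep e xs↭ys) w =
  trans (degree-∷ e xs w) (trans (cong (edgeDegree e w +_) (degree-↭ xs↭ys w)) (sym (degree-∷ e ys w)))
degree-↭ {S = _ ∷ _ ∷ xs} {_ ∷ _ ∷ ys} (swap x y xs↭ys) w = begin
  degree (x ∷ y ∷ xs) w                            ≡⟨ degree-∷ x (y ∷ xs) w ⟩
  edgeDegree x w + degree (y ∷ xs) w               ≡⟨ cong (edgeDegree x w +_) (degree-∷ y xs w) ⟩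
  edgeDegree x w + (edgeDegree y w + degree xs w)  ≡⟨ x∙yz≈y∙xz (edgeDegree x w) (edgeDegree y w) (degree xs w) ⟩
  edgeDegree y w + (edgeDegree x w + degree xs w)  ≡⟨ cong (λ d → edgeDegree y w + (edgeDegree x w + d)) (degree-↭ xs↭ys w) ⟩
  edgeDegree y w + (edgeDegree x w + degree ys w)  ≡⟨ cong (edgeDegree y w +_) (degree-∷ x ys w) ⟨
  edgeDegree y w + degree (x ∷ ys) w               ≡⟨ degree-∷ y (x ∷ ys) w ⟨
  degree (y ∷ x ∷ ys) w                            ∎
  where open ≡-Reasoning
degree-↭ (↭.trans S↭S′ S′↭S″) w = trans (degree-↭ S↭S′ w) (degree-↭ S′↭S″ w)

degree-SameEnds : ∀ {n} {S S′ : List (Edge n)} → Pointwise SameEnds S S′ → ∀ w → degree S w ≡ degree S′ w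
degree-SameEnds [] w = refl
degree-SameEnds {S = (a , b) ∷ S} {_ ∷ S′} (inj₁ (refl , refl) ∷ S~S′) w
  rewrite degree-∷ (a , b) S w | degree-∷ (a , b) S′ w = cong (edgeDegree (a , b) w +_) (degree-SameEnds S~S′ w)
degree-SameEnds {S = (a , b) ∷ S} {_ ∷ S′} (inj₂ (refl , refl) ∷ S~S′) w
  rewrite degree-∷ (a , b) S w | degree-∷ (b , a) S′ w = cong₂ _+_ (ℕP.+-comm ⟦ a == w ⟧ _) (degree-SameEnds S~S′ w)

degree-map-preimage : ∀ {n m} (g : Fin n → Fin m) (S : List (Edge n)) i x →
                      (∀ a → (g a == i) ≡ (a == x)) → degree (map (mapEdge g) S) i ≡ degree S x
degree-map-preimage g []             i x g⁻¹ = refl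
degree-map-preimage g ((a , b) ∷ S) i x g⁻¹ =
  trans (degree-∷ (g a , g b) (map (mapEdge g) S) i)
        (trans (cong₂ _+_ (cong₂ _+_ (cong ⟦_⟧ (g⁻¹ a)) (cong ⟦_⟧ (g⁻¹ b))) (degree-map-preimage g S i x g⁻¹))
               (sym (degree-∷ (a , b) S x)))

degree-map-merge : ∀ {n m} (g : Fin n → Fin m) (S : List (Edge n)) i x y →
                   (∀ a → ⟦ g a == i ⟧ ≡ ⟦ a == x ⟧ + ⟦ a == y ⟧) → degree (map (mapEdge g) S) i ≡ degree S x + degree S y
degree-map-merge g []             i x y g⁻¹ = refl
degree-map-merge g ((a , b) ∷ S) i x y g⁻¹ =
  trans (degree-∷ (g a , g b) (map (mapEdge g) S) i)
        (trans (cong₂ _+_ (cong₂ _+_ (g⁻¹ a) (g⁻¹ b)) (degree-map-merge g S i x y g⁻¹))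
               (trans (regroup ⟦ a == x ⟧ ⟦ a == y ⟧ ⟦ b == x ⟧ ⟦ b == y ⟧ (degree S x) (degree S y))
                      (sym (cong₂ _+_ (degree-∷ (a , b) S x) (degree-∷ (a , b) S y)))))
  where
  regroup : ∀ ax ay bx by dx dy → ax + ay + (bx + by) + (dx + dy) ≡ ax + bx + dx + (ay + by + dy)
  regroup = ℕ-Solver.solve-∀

TwoRegular : ∀ {n} → List (Edge n) → Set
TwoRegular S = ∀ w → degree S w ≡ 2

twoRegular-allF : ∀ {n} (S : List (Edge n)) → twoRegular S ≡ allF (λ w → ⌊ degree S w ℕ.≟ 2 ⌋)
twoRegular-allF {n} S = allB-allFin {n} (λ w → ⌊ degree S w ℕ.≟ 2 ⌋)

twoRegular⇒ : ∀ {n} (S : List (Edge n)) → twoRegular S ≡ true → TwoRegular S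
twoRegular⇒ S e w = ⌊⌋≡true⇒ (degree S w ℕ.≟ 2) (allF⇒∀ _ (trans (sym (twoRegular-allF S)) e) w)

⇒twoRegular : ∀ {n} (S : List (Edge n)) → TwoRegular S → twoRegular S ≡ true
⇒twoRegular S two = trans (twoRegular-allF S) (∀⇒allF _ λ w → ⌊⌋-true (degree S w ℕ.≟ 2) (two w))

twoRegular-cong : ∀ {n m} (S : List (Edge n)) (T : List (Edge m)) →
                  (TwoRegular S → TwoRegular T) → (TwoRegular T → TwoRegular S) → twoRegular S ≡ twoRegular T
twoRegular-cong S T f g = bool-ext (λ e → ⇒twoRegular T (f (twoRegular⇒ S e))) (λ e → ⇒twoRegular S (g (twoRegular⇒ T e)))

reach-isEquivalence : ∀ {n} (S : List (Edge n)) → IsEquivalenceᵇ (reach S)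
reach-isEquivalence S = record
  { r-refl = λ a → Conn⇒reach S a a conn-refl
  ; r-sym = λ {a} {b} e → Conn⇒reach S b a (conn-sym (reach⇒Conn S a b e))
  ; r-trans = λ {a} {b} {c} e f → Conn⇒reach S a c (conn-trans (reach⇒Conn S a b e) (reach⇒Conn S b c f)) }

components-cong : ∀ {n} (S T : List (Edge n)) → (∀ {a b} → (a , b) ∈ S → Conn T a b) → (∀ {a b} → (a , b) ∈ T → Conn S a b) →
  components S ≡ components T
components-cong S T f g = classCount-cong (reach S) (reach T) λ i j → reach-cong S T i j i j (Conn-mono f) (Conn-mono g)

components-↭ : ∀ {n} {S T : List (Edge n)} → S ↭ T → components S ≡ components T
components-↭ {S = S} {T} p = components-cong S T (λ m → conn-edge (↭P.∈-resp-↭ p m)) (λ m → conn-edge (↭P.∈-resp-↭ (↭-sym p) m))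

Conn-∷ : ∀ {n} {S : List (Edge n)} x {a b} → Conn S a b → Conn (x ∷ S) a b
Conn-∷ x = Conn-mono (λ m → conn-edge (there m))

SameEnds⇒Conn : ∀ {n} {S T : List (Edge n)} → Pointwise SameEnds S T → ∀ {a b} → (a , b) ∈ S → Conn T a b
SameEnds⇒Conn (inj₁ (refl , refl) ∷ p) (here refl) = conn-edge (here refl)
SameEnds⇒Conn (inj₂ (refl , refl) ∷ p) (here refl) = conn-sym (conn-edge (here refl))
SameEnds⇒Conn (_∷_ {y = y} _ p) (there m) = Conn-∷ y (SameEnds⇒Conn p m)

SameEnds⇒Conn⁻ : ∀ {n} {S T : List (Edge n)} → Pointwise SameEnds S T → ∀ {a b} → (a , b) ∈ T → Conn S a b
SameEnds⇒Conn⁻ (inj₁ (refl , refl) ∷ p) (here refl) = conn-edge (here refl)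
SameEnds⇒Conn⁻ (inj₂ (refl , refl) ∷ p) (here refl) = conn-sym (conn-edge (here refl))
SameEnds⇒Conn⁻ (_∷_ {x = x} _ p) (there m) = Conn-∷ x (SameEnds⇒Conn⁻ p m)

components-SameEnds : ∀ {n} {S T : List (Edge n)} → Pointwise SameEnds S T → components S ≡ components T
components-SameEnds {S = S} {T} p = components-cong S T (SameEnds⇒Conn p) (SameEnds⇒Conn⁻ p)

∈-mapEdge : ∀ {n m} (g : Fin n → Fin m) {S : List (Edge n)} {a b} → (a , b) ∈ S → (g a , g b) ∈ map (mapEdge g) S
∈-mapEdge g m = ∈-map⁺ (mapEdge g) m

∈-mapEdge⁻ : ∀ {n m} (g : Fin n → Fin m) {S : List (Edge n)} {c d} → (c , d) ∈ map (mapEdge g) S →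
  ∃ λ a → ∃ λ b → (a , b) ∈ S × c ≡ g a × d ≡ g b
∈-mapEdge⁻ g m with ∈-map⁻ (mapEdge g) m
... | (a , b) , m' , refl = a , b , m' , refl , refl

components-permute : ∀ {n m} (π : Permutation n m) (S : List (Edge n)) → components (map (mapEdge (π ⟨$⟩ʳ_)) S) ≡ components S
components-permute π S = sym (classCount-permute π (reach S) (reach T) (reach-isEquivalence S) (reach-isEquivalence T)
  λ x y → reach-cong T S (π ⟨$⟩ʳ x) (π ⟨$⟩ʳ y) x y to fro)
  where
  T = map (mapEdge (π ⟨$⟩ʳ_)) S
  fro : ∀ {x y} → Conn S x y → Conn T (π ⟨$⟩ʳ x) (π ⟨$⟩ʳ y)
  fro = Conn-map (π ⟨$⟩ʳ_) (λ m → conn-edge (∈-mapEdge _ m))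
  to : ∀ {x y} → Conn T (π ⟨$⟩ʳ x) (π ⟨$⟩ʳ y) → Conn S x y
  to {x} {y} c = subst₂ (Conn S) (Perm.inverseˡ π) (Perm.inverseˡ π)
    (Conn-map (π ⟨$⟩ˡ_) (λ m → let (a , b , m' , e1 , e2) = ∈-mapEdge⁻ _ m in
      subst₂ (Conn S) (sym (trans (cong (π ⟨$⟩ˡ_) e1) (Perm.inverseˡ π))) (sym (trans (cong (π ⟨$⟩ˡ_) e2) (Perm.inverseˡ π))) (conn-edge m')) c)

module Merge {n} (u v : Fin (suc n)) (u≢v : u ≢ v) where
  φ : Fin (suc n) → Fin n
  φ = mergeMap u v u≢v

  φ-v≡φ-u : φ v ≡ φ u
  φ-v≡φ-u with v FinP.≟ v | u FinP.≟ v
  ... | yes _ | no u≢v = FinP.punchOut-cong v refl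
  ... | no ¬r | _ = ⊥-elim (¬r refl)
  ... | yes _ | yes u≡v = ⊥-elim (u≢v u≡v)

  φ-≢ : ∀ a (a≢v : a ≢ v) → φ a ≡ punchOut (a≢v ∘ sym)
  φ-≢ a a≢v with a FinP.≟ v
  ... | yes r = ⊥-elim (a≢v r)
  ... | no _ = FinP.punchOut-cong v refl

  φ-punchIn : ∀ i → φ (punchIn v i) ≡ i
  φ-punchIn i = trans (φ-≢ (punchIn v i) (FinP.punchInᵢ≢i v i)) (trans (FinP.punchOut-cong v refl) (FinP.punchOut-punchIn v))

  punchIn-φ : ∀ a → a ≢ v → punchIn v (φ a) ≡ a
  punchIn-φ a a≢v = trans (cong (punchIn v) (φ-≢ a a≢v)) (FinP.punchIn-punchOut _)

  punchIn-φ-u : punchIn v (φ u) ≡ u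
  punchIn-φ-u = punchIn-φ u u≢v

-- v lies in the class of u, so forgetting v loses no component.
components-contract : ∀ {n} (u v : Fin (suc n)) (u≢v : u ≢ v) (S : List (Edge (suc n))) →
                      components ((u , v) ∷ S) ≡ components (map (mapEdge (mergeMap u v u≢v)) S)
components-contract {n} u v u≢v S =
  classCount-merge (reach E) (reach-isEquivalence E) v u u≢v (Conn⇒reach E v u (conn-sym (conn-edge (here refl)))) (reach T)
                   λ i j → reach-cong T E i j (punchIn v i) (punchIn v j) lift project
  where
  open Merge u v u≢v
  E = (u , v) ∷ S
  T = map (mapEdge φ) S
  back : ∀ a → Conn E (punchIn v (φ a)) a
  back a = back-by a (a FinP.≟ v)
    where
    back-by : ∀ a → Dec (a ≡ v) → Conn E (punchIn v (φ a)) a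
    back-by a (yes refl) = subst (λ z → Conn E z v) (sym (trans (cong (punchIn v) φ-v≡φ-u) punchIn-φ-u)) (conn-edge (here refl))
    back-by a (no a≢v)   = subst (λ z → Conn E z a) (sym (punchIn-φ a a≢v)) conn-refl
  lift : ∀ {i j} → Conn T i j → Conn E (punchIn v i) (punchIn v j)
  lift = Conn-map (punchIn v) λ cd∈T → let (a , b , ab∈S , c≡ , d≡) = ∈-mapEdge⁻ φ cd∈T in
           subst₂ (λ c d → Conn E (punchIn v c) (punchIn v d)) (sym c≡) (sym d≡)
                  (conn-trans (back a) (conn-trans (conn-edge (there ab∈S)) (conn-sym (back b))))
  project : ∀ {i j} → Conn E (punchIn v i) (punchIn v j) → Conn T i j
  project c = subst₂ (Conn T) (φ-punchIn _) (φ-punchIn _) (Conn-map φ φ-edge c)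
    where
    φ-edge : ∀ {a b} → (a , b) ∈ E → Conn T (φ a) (φ b)
    φ-edge (here refl)  = subst (Conn T (φ u)) (sym φ-v≡φ-u) conn-refl
    φ-edge (there ab∈S) = conn-edge (∈-mapEdge φ ab∈S)

avoiding-just : ∀ {n} (x : Fin (suc n)) a b (ax : a ≢ x) (bx : b ≢ x) →
  avoiding x (a , b) ≡ just (punchOut (ax ∘ sym) , punchOut (bx ∘ sym))
avoiding-just x a b ax bx with x FinP.≟ a | x FinP.≟ b
... | yes r | _ = ⊥-elim (ax (sym r))
... | no _ | yes r = ⊥-elim (bx (sym r))
... | no _ | no _ = cong₂ (λ c d → just (c , d)) (FinP.punchOut-cong x refl) (FinP.punchOut-cong x refl)

avoiding-just⁻ : ∀ {n} (x : Fin (suc n)) a b c d → avoiding x (a , b) ≡ just (c , d) → punchIn x c ≡ a × punchIn x d ≡ b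
avoiding-just⁻ x a b c d e with x FinP.≟ a | x FinP.≟ b
avoiding-just⁻ x a b c d refl | no xa | no xb = FinP.punchIn-punchOut xa , FinP.punchIn-punchOut xb
avoiding-just⁻ x a b c d () | yes _ | _
avoiding-just⁻ x a b c d () | no _ | yes _

∈-mapMaybe⁻ : ∀ {A B : Set} (f : A → Maybe B) (S : List A) {y} → y ∈ mapMaybe f S → ∃ λ x → x ∈ S × f x ≡ just y
∈-mapMaybe⁻ f (s ∷ S) m with f s in eq
∈-mapMaybe⁻ f (s ∷ S) (here refl) | just z = s , here refl , eq
∈-mapMaybe⁻ f (s ∷ S) (there m) | just z with ∈-mapMaybe⁻ f S m
... | x , m' , e = x , there m' , e
∈-mapMaybe⁻ f (s ∷ S) m | nothing with ∈-mapMaybe⁻ f S m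
... | x , m' , e = x , there m' , e

∈-mapMaybe⁺ : ∀ {A B : Set} (f : A → Maybe B) (S : List A) {x y} → x ∈ S → f x ≡ just y → y ∈ mapMaybe f S
∈-mapMaybe⁺ f (s ∷ S) (here refl) e rewrite e = here refl
∈-mapMaybe⁺ f (s ∷ S) (there m) e with f s
... | just z = there (∈-mapMaybe⁺ f S m e)
... | nothing = ∈-mapMaybe⁺ f S m e

allJust-avoiding⇒ : ∀ {n} (x : Fin (suc n)) (S : List (Edge (suc n))) → allJust (avoiding x) S ≡ true →
  ∀ {a b} → (a , b) ∈ S → a ≢ x × b ≢ x
allJust-avoiding⇒ x ((a , b) ∷ S) e (here refl) with x FinP.≟ a | x FinP.≟ b
... | no xa | no xb = (xa ∘ sym) , (xb ∘ sym)
... | yes _ | _ = ⊥-elim (false≢true e)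
... | no _ | yes _ = ⊥-elim (false≢true e)
allJust-avoiding⇒ x (s ∷ S) e (there m) = allJust-avoiding⇒ x S (proj₂ (∧≡true⇒ {is-just (avoiding x s)} e)) m

SameEnds⇒Conn-head : ∀ {n} {S : List (Edge n)} (ed : Edge n) {x y} → SameEnds ed (x , y) → Conn (ed ∷ S) x y
SameEnds⇒Conn-head (a , b) (inj₁ (refl , refl)) = conn-edge (here refl)
SameEnds⇒Conn-head (a , b) (inj₂ (refl , refl)) = conn-sym (conn-edge (here refl))

SameEnds-collapse : ∀ {n m} (g : Fin n → Fin m) {a b x y} → SameEnds (a , b) (x , y) → g x ≡ g y → g a ≡ g b
SameEnds-collapse g (inj₁ (refl , refl)) e = e
SameEnds-collapse g (inj₂ (refl , refl)) e = sym e

-- x is isolated in S, and the extra edge ed only attaches it to y.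
components-deleteVertex : ∀ {n} (x y : Fin (suc n)) (y≢x : y ≢ x) (ed : Edge (suc n)) → SameEnds ed (x , y) →
                          (S : List (Edge (suc n))) → allJust (avoiding x) S ≡ true →
                          components (mapMaybe (avoiding x) S) ≡ components (ed ∷ S)
components-deleteVertex {n} x y y≢x ed ed~xy S avoids =
  sym (classCount-merge (reach E) (reach-isEquivalence E) x y y≢x (Conn⇒reach E x y (SameEnds⇒Conn-head ed ed~xy)) (reach K)
                        λ i j → reach-cong K E i j (punchIn x i) (punchIn x j) lift project)
  where
  open Merge y x y≢x
  E = ed ∷ S
  K = mapMaybe (avoiding x) S
  lift : ∀ {i j} → Conn K i j → Conn E (punchIn x i) (punchIn x j)
  lift = Conn-map (punchIn x) λ {c} {d} cd∈K → let ((a , b) , ab∈S , kept) = ∈-mapMaybe⁻ (avoiding x) S cd∈K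
                                                   (a≡ , b≡) = avoiding-just⁻ x a b c d kept in
           subst₂ (Conn E) (sym a≡) (sym b≡) (conn-edge (there ab∈S))
  project : ∀ {i j} → Conn E (punchIn x i) (punchIn x j) → Conn K i j
  project c = subst₂ (Conn K) (φ-punchIn _) (φ-punchIn _) (Conn-map φ φ-edge c)
    where
    φ-edge : ∀ {a b} → (a , b) ∈ E → Conn K (φ a) (φ b)
    φ-edge {a}     (here refl)  = subst (Conn K (φ a)) (SameEnds-collapse φ ed~xy φ-v≡φ-u) conn-refl
    φ-edge {a} {b} (there ab∈S) = let (a≢x , b≢x) = allJust-avoiding⇒ x S avoids ab∈S in
      conn-edge (∈-mapMaybe⁺ (avoiding x) S ab∈S
                  (trans (avoiding-just x a b a≢x b≢x) (cong₂ (λ c d → just (c , d)) (sym (φ-≢ a a≢x)) (sym (φ-≢ b b≢x)))))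

-- The per-subset deletion–contraction identity

twoElsewhere : ∀ {n} (S : List (Edge n)) (x y : Fin n) → Bool
twoElsewhere S x y = allF (λ w → (w == x) ∨ ((w == y) ∨ ⌊ degree S w ℕ.≟ 2 ⌋))

twoElsewhere⇒ : ∀ {n} (S : List (Edge n)) x y → twoElsewhere S x y ≡ true → ∀ w → w ≢ x → w ≢ y → degree S w ≡ 2
twoElsewhere⇒ S x y two w w≢x w≢y =
  ⌊⌋≡true⇒ (degree S w ℕ.≟ 2)
    (trans (sym (cong₂ (λ a b → a ∨ (b ∨ ⌊ degree S w ℕ.≟ 2 ⌋)) (≢⇒==false w≢x) (≢⇒==false w≢y)))
           (allF⇒∀ (λ w → (w == x) ∨ ((w == y) ∨ ⌊ degree S w ℕ.≟ 2 ⌋)) two w))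

⇒twoElsewhere : ∀ {n} (S : List (Edge n)) x y → (∀ w → w ≢ x → w ≢ y → degree S w ≡ 2) → twoElsewhere S x y ≡ true
⇒twoElsewhere S x y two = ∀⇒allF _ pointwise
  where
  pointwise : ∀ w → ((w == x) ∨ ((w == y) ∨ ⌊ degree S w ℕ.≟ 2 ⌋)) ≡ true
  pointwise w with w FinP.≟ x | w FinP.≟ y
  ... | yes _  | _      = refl
  ... | no _   | yes _  = refl
  ... | no w≢x | no w≢y = ⌊⌋-true (degree S w ℕ.≟ 2) (two w w≢x w≢y)

twoElsewhere-sym : ∀ {n} (S : List (Edge n)) x y → twoElsewhere S x y ≡ twoElsewhere S y x
twoElsewhere-sym S x y = bool-ext (λ two → ⇒twoElsewhere S y x λ w w≢y w≢x → twoElsewhere⇒ S x y two w w≢x w≢y)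
                                  (λ two → ⇒twoElsewhere S x y λ w w≢x w≢y → twoElsewhere⇒ S y x two w w≢y w≢x)

edgeDegree-ends : ∀ {n} (u v : Fin n) → u ≢ v →
                  edgeDegree (u , v) u ≡ 1 × edgeDegree (u , v) v ≡ 1 × (∀ w → w ≢ u → w ≢ v → edgeDegree (u , v) w ≡ 0)
edgeDegree-ends u v u≢v = at-u , at-v , elsewhere
  where
  at-u : edgeDegree (u , v) u ≡ 1
  at-u rewrite ==-refl u | ≢⇒==false (u≢v ∘ sym) = refl
  at-v : edgeDegree (u , v) v ≡ 1
  at-v rewrite ==-refl v | ≢⇒==false u≢v = refl
  elsewhere : ∀ w → w ≢ u → w ≢ v → edgeDegree (u , v) w ≡ 0
  elsewhere w w≢u w≢v rewrite ≢⇒==false (w≢u ∘ sym) | ≢⇒==false (w≢v ∘ sym) = refl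

twoRegular-∷ : ∀ {n} (u v : Fin n) → u ≢ v → (S : List (Edge n)) →
  twoRegular ((u , v) ∷ S) ≡ (⌊ degree S u ℕ.≟ 1 ⌋ ∧ ⌊ degree S v ℕ.≟ 1 ⌋) ∧ twoElsewhere S u v
twoRegular-∷ u v u≢v S = bool-ext fwd bwd
  where
  ends = edgeDegree-ends u v u≢v
  E = (u , v) ∷ S
  fwd : twoRegular E ≡ true → (⌊ degree S u ℕ.≟ 1 ⌋ ∧ ⌊ degree S v ℕ.≟ 1 ⌋) ∧ twoElsewhere S u v ≡ true
  fwd e = ∧-true (∧-true (⌊⌋-true (degree S u ℕ.≟ 1) (at-end u (proj₁ ends))) (⌊⌋-true (degree S v ℕ.≟ 1) (at-end v (proj₁ (proj₂ ends)))))
                 (⇒twoElsewhere S u v λ w w≢u w≢v → trans (cong (_+ degree S w) (sym (proj₂ (proj₂ ends) w w≢u w≢v))) (at w))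
    where
    at : ∀ w → edgeDegree (u , v) w + degree S w ≡ 2
    at w = trans (sym (degree-∷ (u , v) S w)) (twoRegular⇒ E e w)
    at-end : ∀ w → edgeDegree (u , v) w ≡ 1 → degree S w ≡ 1
    at-end w one = ℕP.suc-injective (trans (cong (_+ degree S w) (sym one)) (at w))
  bwd : (⌊ degree S u ℕ.≟ 1 ⌋ ∧ ⌊ degree S v ℕ.≟ 1 ⌋) ∧ twoElsewhere S u v ≡ true → twoRegular E ≡ true
  bwd e = ⇒twoRegular E two
    where
    split = ∧≡true⇒ {⌊ degree S u ℕ.≟ 1 ⌋ ∧ ⌊ degree S v ℕ.≟ 1 ⌋} e
    split′ = ∧≡true⇒ {⌊ degree S u ℕ.≟ 1 ⌋} (proj₁ split)
    du = ⌊⌋≡true⇒ (degree S u ℕ.≟ 1) (proj₁ split′)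
    dv = ⌊⌋≡true⇒ (degree S v ℕ.≟ 1) (proj₂ split′)
    two : TwoRegular E
    two w with w FinP.≟ u | w FinP.≟ v
    ... | yes refl | _ = trans (degree-∷ (u , v) S u) (cong₂ _+_ (proj₁ ends) du)
    ... | no _ | yes refl = trans (degree-∷ (u , v) S v) (cong₂ _+_ (proj₁ (proj₂ ends)) dv)
    ... | no w≢u | no w≢v = trans (degree-∷ (u , v) S w) (cong₂ _+_ (proj₂ (proj₂ ends) w w≢u w≢v) (twoElsewhere⇒ S u v (proj₂ split) w w≢u w≢v))

module MergeDegrees {n} (u v : Fin (suc n)) (u≢v : u ≢ v) where
  open Merge u v u≢v

  merged-indicator : ∀ a → ⟦ φ a == φ u ⟧ ≡ ⟦ a == u ⟧ + ⟦ a == v ⟧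
  merged-indicator a = by-cases a (a FinP.≟ v)
    where
    by-cases : ∀ a → Dec (a ≡ v) → ⟦ φ a == φ u ⟧ ≡ ⟦ a == u ⟧ + ⟦ a == v ⟧
    by-cases a (yes refl) rewrite φ-v≡φ-u | ==-refl (φ u) | ≢⇒==false (u≢v ∘ sym) | ==-refl v = refl
    by-cases a (no a≢v) rewrite ≢⇒==false a≢v | ℕP.+-identityʳ ⟦ a == u ⟧ =
      cong ⟦_⟧ (==-cong (λ e → trans (sym (punchIn-φ a a≢v)) (trans (cong (punchIn v) e) punchIn-φ-u)) (cong φ))

  unmerged-indicator : ∀ i → i ≢ φ u → ∀ a → (φ a == i) ≡ (a == punchIn v i)
  unmerged-indicator i i≢φu a = by-cases a (a FinP.≟ v)
    where
    by-cases : ∀ a → Dec (a ≡ v) → (φ a == i) ≡ (a == punchIn v i)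
    by-cases a (yes refl) rewrite φ-v≡φ-u | ≢⇒==false (i≢φu ∘ sym) | ≢⇒==false (FinP.punchInᵢ≢i v i ∘ sym) = refl
    by-cases a (no a≢v) = ==-cong (λ e → trans (sym (punchIn-φ a a≢v)) (cong (punchIn v) e)) (λ e → trans (cong φ e) (φ-punchIn i))

  degree-merged : ∀ S → degree (map (mapEdge φ) S) (φ u) ≡ degree S u + degree S v
  degree-merged S = degree-map-merge φ S (φ u) u v merged-indicator

  degree-unmerged : ∀ S i → i ≢ φ u → degree (map (mapEdge φ) S) i ≡ degree S (punchIn v i)
  degree-unmerged S i i≢φu = degree-map-preimage φ S i (punchIn v i) (unmerged-indicator i i≢φu)

  twoRegular-merge : ∀ S → twoRegular (map (mapEdge φ) S) ≡ ⌊ degree S u + degree S v ℕ.≟ 2 ⌋ ∧ twoElsewhere S u v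
  twoRegular-merge S = bool-ext fwd bwd
    where
    M = map (mapEdge φ) S
    fwd : twoRegular M ≡ true → ⌊ degree S u + degree S v ℕ.≟ 2 ⌋ ∧ twoElsewhere S u v ≡ true
    fwd e = ∧-true (⌊⌋-true (degree S u + degree S v ℕ.≟ 2) (trans (sym (degree-merged S)) (two (φ u))))
                    (⇒twoElsewhere S u v λ w w≢u w≢v → two-at w w≢u w≢v)
      where
      two = twoRegular⇒ M e
      two-at : ∀ w → w ≢ u → w ≢ v → degree S w ≡ 2
      two-at w w≢u w≢v = trans (cong (degree S) (sym punchIn-i)) (trans (sym (degree-unmerged S i i≢φu)) (two i))
        where
        i = punchOut (w≢v ∘ sym)
        punchIn-i : punchIn v i ≡ w
        punchIn-i = FinP.punchIn-punchOut (w≢v ∘ sym)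
        i≢φu : i ≢ φ u
        i≢φu e = w≢u (trans (sym punchIn-i) (trans (cong (punchIn v) e) punchIn-φ-u))
    bwd : ⌊ degree S u + degree S v ℕ.≟ 2 ⌋ ∧ twoElsewhere S u v ≡ true → twoRegular M ≡ true
    bwd e = ⇒twoRegular M two
      where
      split = ∧≡true⇒ {⌊ degree S u + degree S v ℕ.≟ 2 ⌋} e
      two : TwoRegular M
      two i with i FinP.≟ φ u
      ... | yes refl = trans (degree-merged S) (⌊⌋≡true⇒ (degree S u + degree S v ℕ.≟ 2) (proj₁ split))
      ... | no i≢φu = trans (degree-unmerged S i i≢φu) (twoElsewhere⇒ S u v (proj₂ split) (punchIn v i)
              (λ q → i≢φu (trans (sym (φ-punchIn i)) (cong φ q))) (FinP.punchInᵢ≢i v i))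

⟦⟧+⟦⟧+-≢0 : ∀ c d k → c ≡ true ⊎ d ≡ true → ⟦ c ⟧ + ⟦ d ⟧ + k ≢ 0
⟦⟧+⟦⟧+-≢0 true  d     k _         ()
⟦⟧+⟦⟧+-≢0 false true  k _         ()
⟦⟧+⟦⟧+-≢0 false false k (inj₁ ()) _
⟦⟧+⟦⟧+-≢0 false false k (inj₂ ()) _

degree≡0⇒avoids : ∀ {n} (S : List (Edge n)) x → degree S x ≡ 0 → ∀ {a b} → (a , b) ∈ S → a ≢ x × b ≢ x
degree≡0⇒avoids ((a , b) ∷ S) x deg≡0 (here refl) = by-cases (a FinP.≟ x) (b FinP.≟ x)
  where
  sum≡0 = trans (sym (degree-∷ (a , b) S x)) deg≡0
  by-cases : Dec (a ≡ x) → Dec (b ≡ x) → a ≢ x × b ≢ x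
  by-cases (no a≢x) (no b≢x) = a≢x , b≢x
  by-cases (yes a≡x) _       = ⊥-elim (⟦⟧+⟦⟧+-≢0 (a == x) (b == x) (degree S x) (inj₁ (≡⇒== a≡x)) sum≡0)
  by-cases (no _)   (yes b≡x) = ⊥-elim (⟦⟧+⟦⟧+-≢0 (a == x) (b == x) (degree S x) (inj₂ (≡⇒== b≡x)) sum≡0)
degree≡0⇒avoids ((a , b) ∷ S) x deg≡0 (there ab∈S) =
  degree≡0⇒avoids S x (ℕP.m+n≡0⇒n≡0 (edgeDegree (a , b) x) (trans (sym (degree-∷ (a , b) S x)) deg≡0)) ab∈S

avoids⇒degree≡0 : ∀ {n} (S : List (Edge n)) x → (∀ {a b} → (a , b) ∈ S → a ≢ x × b ≢ x) → degree S x ≡ 0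
avoids⇒degree≡0 []             x avoids = refl
avoids⇒degree≡0 ((a , b) ∷ S) x avoids = trans (degree-∷ (a , b) S x) (cong₂ _+_ misses (avoids⇒degree≡0 S x (avoids ∘ there)))
  where
  misses : edgeDegree (a , b) x ≡ 0
  misses rewrite ≢⇒==false (proj₁ (avoids (here refl))) | ≢⇒==false (proj₂ (avoids (here refl))) = refl

avoids⇒allJust : ∀ {n} (x : Fin (suc n)) (S : List (Edge (suc n))) → (∀ {a b} → (a , b) ∈ S → a ≢ x × b ≢ x) → allJust (avoiding x) S ≡ true
avoids⇒allJust x []             avoids = refl
avoids⇒allJust x ((a , b) ∷ S) avoids rewrite avoiding-just x a b (proj₁ (avoids (here refl))) (proj₂ (avoids (here refl))) =
  avoids⇒allJust x S (avoids ∘ there)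

allJust-avoiding : ∀ {n} (x : Fin (suc n)) (S : List (Edge (suc n))) → allJust (avoiding x) S ≡ ⌊ degree S x ℕ.≟ 0 ⌋
allJust-avoiding x S = bool-ext (λ e → ⌊⌋-true (degree S x ℕ.≟ 0) (avoids⇒degree≡0 S x (allJust-avoiding⇒ x S e)))
                        (λ e → avoids⇒allJust x S (degree≡0⇒avoids S x (⌊⌋≡true⇒ (degree S x ℕ.≟ 0) e)))

degree-avoiding : ∀ {n} (x : Fin (suc n)) (S : List (Edge (suc n))) → allJust (avoiding x) S ≡ true →
  ∀ i → degree (mapMaybe (avoiding x) S) i ≡ degree S (punchIn x i)
degree-avoiding x [] avoids i = refl
degree-avoiding x ((a , b) ∷ S) avoids i with allJust-avoiding⇒ x ((a , b) ∷ S) avoids (here refl)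
... | ax , bx rewrite avoiding-just x a b ax bx =
  trans (degree-∷ (punchOut (ax ∘ sym) , punchOut (bx ∘ sym)) (mapMaybe (avoiding x) S) i)
    (trans (cong₂ _+_ (cong₂ _+_ (cong ⟦_⟧ (punchOut≡ a ax)) (cong ⟦_⟧ (punchOut≡ b bx))) (degree-avoiding x S (proj₂ (∧≡true⇒ {true} avoids)) i))
      (sym (degree-∷ (a , b) S (punchIn x i))))
  where
  punchOut≡ : ∀ c (cx : c ≢ x) → (punchOut (cx ∘ sym) == i) ≡ (c == punchIn x i)
  punchOut≡ c cx = ==-cong (λ e → trans (sym (FinP.punchIn-punchOut (cx ∘ sym))) (cong (punchIn x) e))
                  (λ e → trans (FinP.punchOut-cong x e) (FinP.punchOut-punchIn x))

twoRegular-deleteVertex : ∀ {n} (x y : Fin (suc n)) → x ≢ y → (S : List (Edge (suc n))) →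
  allJust (avoiding x) S ∧ twoRegular (mapMaybe (avoiding x) S) ≡ (⌊ degree S x ℕ.≟ 0 ⌋ ∧ ⌊ degree S y ℕ.≟ 2 ⌋) ∧ twoElsewhere S x y
twoRegular-deleteVertex x y x≢y S = bool-ext fwd bwd
  where
  K = mapMaybe (avoiding x) S
  fwd : allJust (avoiding x) S ∧ twoRegular K ≡ true → (⌊ degree S x ℕ.≟ 0 ⌋ ∧ ⌊ degree S y ℕ.≟ 2 ⌋) ∧ twoElsewhere S x y ≡ true
  fwd e = ∧-true (∧-true (trans (sym (allJust-avoiding x S)) avoids)
                           (⌊⌋-true (degree S y ℕ.≟ 2) (two-at y (x≢y ∘ sym))))
                  (⇒twoElsewhere S x y λ w w≢x w≢y → two-at w w≢x)
    where
    split = ∧≡true⇒ {allJust (avoiding x) S} e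
    avoids = proj₁ split
    two = twoRegular⇒ K (proj₂ split)
    two-at : ∀ w → w ≢ x → degree S w ≡ 2
    two-at w w≢x = trans (cong (degree S) (sym (FinP.punchIn-punchOut (w≢x ∘ sym)))) (trans (sym (degree-avoiding x S avoids _)) (two _))
  bwd : (⌊ degree S x ℕ.≟ 0 ⌋ ∧ ⌊ degree S y ℕ.≟ 2 ⌋) ∧ twoElsewhere S x y ≡ true → allJust (avoiding x) S ∧ twoRegular K ≡ true
  bwd e = ∧-true avoids (⇒twoRegular K two)
    where
    split = ∧≡true⇒ {⌊ degree S x ℕ.≟ 0 ⌋ ∧ ⌊ degree S y ℕ.≟ 2 ⌋} e
    split′ = ∧≡true⇒ {⌊ degree S x ℕ.≟ 0 ⌋} (proj₁ split)
    avoids = trans (allJust-avoiding x S) (proj₁ split′)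
    two : TwoRegular K
    two i with punchIn x i FinP.≟ y
    ... | yes q = trans (degree-avoiding x S avoids i) (trans (cong (degree S) q) (⌊⌋≡true⇒ (degree S y ℕ.≟ 2) (proj₂ split′)))
    ... | no q = trans (degree-avoiding x S avoids i) (twoElsewhere⇒ S x y (proj₂ split) (punchIn x i) (FinP.punchInᵢ≢i x i) q)

isHC : ∀ {n} → ℕ → List (Edge n) → Bool
isHC k S = twoRegular S ∧ ⌊ components S ℕ.≟ k ⌋

degree-cases : ∀ du dv (rest : Bool) →
               ⟦ (⌊ du ℕ.≟ 1 ⌋ ∧ ⌊ dv ℕ.≟ 1 ⌋) ∧ rest ⟧ + ⟦ (⌊ du ℕ.≟ 0 ⌋ ∧ ⌊ dv ℕ.≟ 2 ⌋) ∧ rest ⟧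
                 + ⟦ (⌊ dv ℕ.≟ 0 ⌋ ∧ ⌊ du ℕ.≟ 2 ⌋) ∧ rest ⟧
               ≡ ⟦ ⌊ du + dv ℕ.≟ 2 ⌋ ∧ rest ⟧
degree-cases 0                   0                   rest = refl
degree-cases 0                   1                   rest = refl
degree-cases 0                   2                   rest = ℕP.+-identityʳ _
degree-cases 0                   (suc (suc (suc _))) rest = refl
degree-cases 1                   0                   rest = refl
degree-cases 1                   1                   rest = trans (ℕP.+-identityʳ _) (ℕP.+-identityʳ _)
degree-cases 1                   (suc (suc _))       rest = refl
degree-cases 2                   0                   rest = refl
degree-cases 2                   (suc _)             rest = refl
degree-cases (suc (suc (suc _))) zero                rest = refl
degree-cases (suc (suc (suc _))) (suc _)             rest = refl

∧-guard : ∀ (g t c c′ X : Bool) → g ∧ t ≡ X → (g ≡ true → c ≡ c′) → (X ≡ true → g ≡ true) → g ∧ (t ∧ c) ≡ X ∧ c′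
∧-guard true  t c c′ X     gt≡X c≡c′ _ rewrite c≡c′ refl = cong (_∧ c′) gt≡X
∧-guard false t c c′ false _    _    _ = refl
∧-guard false t c c′ true  _    _    X⇒g = ⊥-elim (false≢true (X⇒g refl))

isHC-deletion-contraction : ∀ {n} (u v : Fin (suc n)) (u≢v : u ≢ v) k (S : List (Edge (suc n))) →
  ⟦ isHC k ((u , v) ∷ S) ⟧ + ⟦ allJust (avoiding u) S ∧ isHC k (mapMaybe (avoiding u) S) ⟧
    + ⟦ allJust (avoiding v) S ∧ isHC k (mapMaybe (avoiding v) S) ⟧
  ≡ ⟦ isHC k (map (mapEdge (mergeMap u v u≢v)) S) ⟧
isHC-deletion-contraction {n} u v u≢v k S =
  trans (cong₂ _+_ (cong₂ _+_ (cong ⟦_⟧ with-e) (cong ⟦_⟧ without-u)) (cong ⟦_⟧ without-v))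
        (trans (degree-cases du dv (elsewhere ∧ c)) (cong ⟦_⟧ (sym merged)))
  where
  du = degree S u
  dv = degree S v
  elsewhere = twoElsewhere S u v
  S/e = map (mapEdge (mergeMap u v u≢v)) S
  c = ⌊ components S/e ℕ.≟ k ⌋
  ≟k-cong : ∀ {a b} → a ≡ b → ⌊ a ℕ.≟ k ⌋ ≡ ⌊ b ℕ.≟ k ⌋
  ≟k-cong = cong (λ a → ⌊ a ℕ.≟ k ⌋)
  with-e : isHC k ((u , v) ∷ S) ≡ (⌊ du ℕ.≟ 1 ⌋ ∧ ⌊ dv ℕ.≟ 1 ⌋) ∧ (elsewhere ∧ c)
  with-e = trans (cong₂ _∧_ (twoRegular-∷ u v u≢v S) (≟k-cong (components-contract u v u≢v S))) (BoolP.∧-assoc (⌊ du ℕ.≟ 1 ⌋ ∧ ⌊ dv ℕ.≟ 1 ⌋) elsewhere c)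
  merged : isHC k S/e ≡ ⌊ du + dv ℕ.≟ 2 ⌋ ∧ (elsewhere ∧ c)
  merged = trans (cong (_∧ c) (MergeDegrees.twoRegular-merge u v u≢v S)) (BoolP.∧-assoc ⌊ du + dv ℕ.≟ 2 ⌋ elsewhere c)
  without-u : allJust (avoiding u) S ∧ isHC k (mapMaybe (avoiding u) S) ≡ (⌊ du ℕ.≟ 0 ⌋ ∧ ⌊ dv ℕ.≟ 2 ⌋) ∧ (elsewhere ∧ c)
  without-u = trans (∧-guard (allJust (avoiding u) S) _ _ c _ (twoRegular-deleteVertex u v u≢v S)
                      (λ avoids → ≟k-cong (trans (components-deleteVertex u v (u≢v ∘ sym) (u , v) (inj₁ (refl , refl)) S avoids)
                                                 (components-contract u v u≢v S)))
                      (λ X → trans (allJust-avoiding u S) (proj₁ (∧≡true⇒ (proj₁ (∧≡true⇒ X))))))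
                    (BoolP.∧-assoc (⌊ du ℕ.≟ 0 ⌋ ∧ ⌊ dv ℕ.≟ 2 ⌋) elsewhere c)
  without-v : allJust (avoiding v) S ∧ isHC k (mapMaybe (avoiding v) S) ≡ (⌊ dv ℕ.≟ 0 ⌋ ∧ ⌊ du ℕ.≟ 2 ⌋) ∧ (elsewhere ∧ c)
  without-v = trans (∧-guard (allJust (avoiding v) S) _ _ c _
                      (trans (twoRegular-deleteVertex v u (u≢v ∘ sym) S) (cong ((⌊ dv ℕ.≟ 0 ⌋ ∧ ⌊ du ℕ.≟ 2 ⌋) ∧_) (twoElsewhere-sym S v u)))
                      (λ avoids → ≟k-cong (trans (components-deleteVertex v u u≢v (u , v) (inj₂ (refl , refl)) S avoids)
                                                 (components-contract u v u≢v S)))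
                      (λ X → trans (allJust-avoiding v S) (proj₁ (∧≡true⇒ (proj₁ (∧≡true⇒ X))))))
                    (BoolP.∧-assoc (⌊ dv ℕ.≟ 0 ⌋ ∧ ⌊ du ℕ.≟ 2 ⌋) elsewhere c)

module _ {A : Set} where

  ∑-sub : (List A → ℕ) → List A → ℕ
  ∑-sub f []       = f []
  ∑-sub f (x ∷ xs) = ∑-sub (f ∘ (x ∷_)) xs + ∑-sub f xs

  countSub : (List A → Bool) → List A → ℕ
  countSub p = ∑-sub (⟦_⟧ ∘ p)

  countSub-subsets : ∀ p xs → length (filter (λ S → p S BoolP.≟ true) (subsets xs)) ≡ countSub p xs
  countSub-subsets p []       with p []
  ... | true  = refl
  ... | false = refl
  countSub-subsets p (x ∷ xs) = begin
    length (filter p? (map (x ∷_) (subsets xs) ++ subsets xs))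
      ≡⟨ cong length (ListP.filter-++ p? (map (x ∷_) (subsets xs)) (subsets xs)) ⟩
    length (filter p? (map (x ∷_) (subsets xs)) ++ filter p? (subsets xs))
      ≡⟨ ListP.length-++ (filter p? (map (x ∷_) (subsets xs))) ⟩
    length (filter p? (map (x ∷_) (subsets xs))) + length (filter p? (subsets xs))
      ≡⟨ cong (_+ length (filter p? (subsets xs))) (length-filter-map p (x ∷_) (subsets xs)) ⟩
    length (filter (λ S → p (x ∷ S) BoolP.≟ true) (subsets xs)) + length (filter p? (subsets xs))
      ≡⟨ cong₂ _+_ (countSub-subsets (p ∘ (x ∷_)) xs) (countSub-subsets p xs) ⟩
    countSub p (x ∷ xs) ∎
    where
    open ≡-Reasoning
    p? = λ S → p S BoolP.≟ true
    length-filter-map : ∀ (q : List A → Bool) (g : List A → List A) Ss →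
      length (filter (λ S → q S BoolP.≟ true) (map g Ss)) ≡ length (filter (λ S → q (g S) BoolP.≟ true) Ss)
    length-filter-map q g []       = refl
    length-filter-map q g (S ∷ Ss) with q (g S)
    ... | true  = cong suc (length-filter-map q g Ss)
    ... | false = length-filter-map q g Ss

  ∑-sub-cong : ∀ {f g : List A → ℕ} → (∀ S → f S ≡ g S) → ∀ xs → ∑-sub f xs ≡ ∑-sub g xs
  ∑-sub-cong f≗g []       = f≗g []
  ∑-sub-cong f≗g (x ∷ xs) = cong₂ _+_ (∑-sub-cong (f≗g ∘ (x ∷_)) xs) (∑-sub-cong f≗g xs)

  ∑-sub-+ : ∀ (f g : List A → ℕ) xs → ∑-sub (λ S → f S + g S) xs ≡ ∑-sub f xs + ∑-sub g xs
  ∑-sub-+ f g []       = refl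
  ∑-sub-+ f g (x ∷ xs) rewrite ∑-sub-+ (f ∘ (x ∷_)) (g ∘ (x ∷_)) xs | ∑-sub-+ f g xs =
    interchange (∑-sub (f ∘ (x ∷_)) xs) (∑-sub (g ∘ (x ∷_)) xs) (∑-sub f xs) (∑-sub g xs)

  ∑-sub-zero : ∀ (f : List A → ℕ) → (∀ S → f S ≡ 0) → ∀ xs → ∑-sub f xs ≡ 0
  ∑-sub-zero f f≡0 []       = f≡0 []
  ∑-sub-zero f f≡0 (x ∷ xs) rewrite ∑-sub-zero (f ∘ (x ∷_)) (f≡0 ∘ (x ∷_)) xs | ∑-sub-zero f f≡0 xs = refl

  ∑-sub-↭ : ∀ (f : List A → ℕ) → (∀ {S S′} → S ↭ S′ → f S ≡ f S′) → ∀ {xs ys} → xs ↭ ys → ∑-sub f xs ≡ ∑-sub f ys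
  ∑-sub-↭ f f-↭ ↭.refl        = refl
  ∑-sub-↭ f f-↭ (prep x xs↭ys) = cong₂ _+_ (∑-sub-↭ (f ∘ (x ∷_)) (f-↭ ∘ prep x) xs↭ys) (∑-sub-↭ f f-↭ xs↭ys)
  ∑-sub-↭ f f-↭ {x ∷ y ∷ xs} {.y ∷ .x ∷ ys} (swap x y xs↭ys) =
    trans (cong₂ _+_ (cong₂ _+_ (trans (∑-sub-↭ (f ∘ (x ∷_) ∘ (y ∷_)) (f-↭ ∘ prep x ∘ prep y) xs↭ys)
                                       (∑-sub-cong (λ _ → f-↭ (swap x y ↭.refl)) ys))
                                (∑-sub-↭ (f ∘ (x ∷_)) (f-↭ ∘ prep x) xs↭ys))
                     (cong₂ _+_ (∑-sub-↭ (f ∘ (y ∷_)) (f-↭ ∘ prep y) xs↭ys) (∑-sub-↭ f f-↭ xs↭ys)))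
          (interchange (∑-sub (λ S → f (y ∷ x ∷ S)) ys) (∑-sub (f ∘ (x ∷_)) ys) (∑-sub (f ∘ (y ∷_)) ys) (∑-sub f ys))
  ∑-sub-↭ f f-↭ (↭.trans xs↭ys ys↭zs) = trans (∑-sub-↭ f f-↭ xs↭ys) (∑-sub-↭ f f-↭ ys↭zs)

  ∑-sub-Pointwise : ∀ (R : A → A → Set) (f g : List A → ℕ) → (∀ {S S′} → Pointwise R S S′ → f S ≡ g S′) →
                    ∀ {xs ys} → Pointwise R xs ys → ∑-sub f xs ≡ ∑-sub g ys
  ∑-sub-Pointwise R f g f≡g []         = f≡g []
  ∑-sub-Pointwise R f g f≡g (xRy ∷ xsRys) =
    cong₂ _+_ (∑-sub-Pointwise R _ _ (f≡g ∘ (xRy ∷_)) xsRys) (∑-sub-Pointwise R f g f≡g xsRys)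

∑-sub-map : ∀ {A B : Set} (f : List B → ℕ) (g : A → B) xs → ∑-sub f (map g xs) ≡ ∑-sub (f ∘ map g) xs
∑-sub-map f g []       = refl
∑-sub-map f g (x ∷ xs) = cong₂ _+_ (∑-sub-map (f ∘ (g x ∷_)) g xs) (∑-sub-map f g xs)

-- A sublist of xs is sent into mapMaybe g xs only when g is defined on all of it.
countSub-mapMaybe : ∀ {A B : Set} (p : List B → Bool) (g : A → Maybe B) xs →
                    countSub p (mapMaybe g xs) ≡ countSub (λ S → allJust g S ∧ p (mapMaybe g S)) xs
countSub-mapMaybe p g []       = refl
countSub-mapMaybe p g (x ∷ xs) with g x
... | nothing = trans (countSub-mapMaybe p g xs)
                      (cong (_+ countSub (λ S → allJust g S ∧ p (mapMaybe g S)) xs) (sym (∑-sub-zero _ (λ _ → refl) xs)))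
... | just y  = cong₂ _+_ (countSub-mapMaybe (p ∘ (y ∷_)) g xs) (countSub-mapMaybe p g xs)

h≡countSub : ∀ k n (es : List (Edge n)) → h k (mkGraph n es) ≡ countSub (isHC k) es
h≡countSub k n es = countSub-subsets (isHC k) es

isHC-↭ : ∀ {n} k {S S′ : List (Edge n)} → S ↭ S′ → isHC k S ≡ isHC k S′
isHC-↭ k {S} {S′} S↭S′ =
  cong₂ _∧_ (twoRegular-cong S S′ (λ two w → trans (sym (degree-↭ S↭S′ w)) (two w)) (λ two w → trans (degree-↭ S↭S′ w) (two w)))
            (cong (λ c → ⌊ c ℕ.≟ k ⌋) (components-↭ S↭S′))

isHC-SameEnds : ∀ {n} k {S S′ : List (Edge n)} → Pointwise SameEnds S S′ → isHC k S ≡ isHC k S′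
isHC-SameEnds k {S} {S′} S~S′ =
  cong₂ _∧_ (twoRegular-cong S S′ (λ two w → trans (sym (degree-SameEnds S~S′ w)) (two w)) (λ two w → trans (degree-SameEnds S~S′ w) (two w)))
            (cong (λ c → ⌊ c ℕ.≟ k ⌋) (components-SameEnds S~S′))

isHC-permute : ∀ {n m} k (π : Permutation n m) (S : List (Edge n)) → isHC k (map (mapEdge (π ⟨$⟩ʳ_)) S) ≡ isHC k S
isHC-permute k π S = cong₂ _∧_ (twoRegular-cong πS S to from) (cong (λ c → ⌊ c ℕ.≟ k ⌋) (components-permute π S))
  where
  πS = map (mapEdge (π ⟨$⟩ʳ_)) S
  degree-πS : ∀ w → degree πS (π ⟨$⟩ʳ w) ≡ degree S w
  degree-πS w = degree-map-preimage (π ⟨$⟩ʳ_) S (π ⟨$⟩ʳ w) w λ a →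
    ==-cong (λ πa≡πw → trans (sym (Perm.inverseˡ π)) (trans (cong (π ⟨$⟩ˡ_) πa≡πw) (Perm.inverseˡ π))) (cong (π ⟨$⟩ʳ_))
  to : TwoRegular πS → TwoRegular S
  to two w = trans (sym (degree-πS w)) (two _)
  from : TwoRegular S → TwoRegular πS
  from two w = trans (cong (degree πS) (sym (Perm.inverseʳ π))) (trans (degree-πS _) (two _))

h-≅ : ∀ k G G′ → G ≅ G′ → h k G ≡ h k G′
h-≅ k (mkGraph n es) (mkGraph m es′) (π , πes , πes~ , πes↭es′) = begin
  h k (mkGraph n es)                                  ≡⟨ h≡countSub k n es ⟩
  countSub (isHC k) es                                ≡⟨ ∑-sub-cong (λ S → cong ⟦_⟧ (isHC-permute k π S)) es ⟨
  countSub (isHC k ∘ map (mapEdge (Inverse.to π))) es ≡⟨ ∑-sub-map (⟦_⟧ ∘ isHC k) (mapEdge (Inverse.to π)) es ⟨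
  countSub (isHC k) (map (mapEdge (Inverse.to π)) es) ≡⟨ ∑-sub-Pointwise SameEnds _ _ (cong ⟦_⟧ ∘ isHC-SameEnds k) πes~ ⟩
  countSub (isHC k) πes                               ≡⟨ ∑-sub-↭ (⟦_⟧ ∘ isHC k) (cong ⟦_⟧ ∘ isHC-↭ k) πes↭es′ ⟩
  countSub (isHC k) es′                               ≡⟨ h≡countSub k m es′ ⟨
  h k (mkGraph m es′)                                 ∎
  where open ≡-Reasoning

lookup∷removeAt-↭ : ∀ {A : Set} (xs : List A) i → xs ↭ lookup xs i ∷ removeAt xs i
lookup∷removeAt-↭ (x ∷ xs) zero    = ↭.refl
lookup∷removeAt-↭ (x ∷ xs) (suc i) = ↭-trans (prep x (lookup∷removeAt-↭ xs i)) (swap x (lookup xs i) ↭.refl)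

avoiding-first : ∀ {n} (x : Fin (suc n)) b → avoiding x (x , b) ≡ nothing
avoiding-first x b with x FinP.≟ x
... | yes _   = refl
... | no x≢x  = ⊥-elim (x≢x refl)

avoiding-second : ∀ {n} (x : Fin (suc n)) a → avoiding x (a , x) ≡ nothing
avoiding-second x a with x FinP.≟ a | x FinP.≟ x
... | yes _ | _       = refl
... | no _  | yes _   = refl
... | no _  | no x≢x  = ⊥-elim (x≢x refl)

h-deletion-contraction : ∀ k n (es : List (Edge (suc n))) (e : Fin (length es)) (u≢v : proj₁ (lookup es e) ≢ proj₂ (lookup es e)) →
                         h k (mkGraph (suc n) es) + h k (deleteVertex es (proj₁ (lookup es e))) + h k (deleteVertex es (proj₂ (lookup es e)))
                         ≡ h k (deleteEdge (mkGraph (suc n) es) e) + h k (contract es e u≢v)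
h-deletion-contraction k n es e u≢v = begin
  h k (mkGraph (suc n) es) + h k (deleteVertex es u) + h k (deleteVertex es v)
    ≡⟨ cong₂ _+_ (cong₂ _+_ h-G (h-G-x u (avoiding-first u v))) (h-G-x v (avoiding-second v u)) ⟩
  countSub (isHC k ∘ (uv ∷_)) rest + countSub (isHC k) rest + without u + without v
    ≡⟨ regroup (countSub (isHC k ∘ (uv ∷_)) rest) (countSub (isHC k) rest) (without u) (without v) ⟩
  countSub (isHC k) rest + (countSub (isHC k ∘ (uv ∷_)) rest + without u + without v)
    ≡⟨ cong₂ _+_ (sym (h≡countSub k (suc n) rest)) (sym three-sums) ⟩
  h k (deleteEdge (mkGraph (suc n) es) e) + ∑-sub (λ S → ⟦ isHC k (uv ∷ S) ⟧ + ⟦ avoids u S ⟧ + ⟦ avoids v S ⟧) rest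
    ≡⟨ cong (h k (deleteEdge (mkGraph (suc n) es) e) +_) (∑-sub-cong (isHC-deletion-contraction u v u≢v k) rest) ⟩
  h k (deleteEdge (mkGraph (suc n) es) e) + countSub (isHC k ∘ map (mapEdge (mergeMap u v u≢v))) rest
    ≡⟨ cong (h k (deleteEdge (mkGraph (suc n) es) e) +_) h-G/e ⟨
  h k (deleteEdge (mkGraph (suc n) es) e) + h k (contract es e u≢v) ∎
  where
  open ≡-Reasoning
  uv = lookup es e
  u = proj₁ uv
  v = proj₂ uv
  rest = removeAt es e
  avoids : Fin (suc n) → List (Edge (suc n)) → Bool
  avoids x S = allJust (avoiding x) S ∧ isHC k (mapMaybe (avoiding x) S)
  without : Fin (suc n) → ℕ
  without x = countSub (avoids x) rest
  h-G : h k (mkGraph (suc n) es) ≡ countSub (isHC k) (uv ∷ rest)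
  h-G = trans (h≡countSub k (suc n) es) (∑-sub-↭ (⟦_⟧ ∘ isHC k) (cong ⟦_⟧ ∘ isHC-↭ k) (lookup∷removeAt-↭ es e))
  h-G/e : h k (contract es e u≢v) ≡ countSub (isHC k ∘ map (mapEdge (mergeMap u v u≢v))) rest
  h-G/e = trans (h≡countSub k n (edges (contract es e u≢v)))
                (trans (cong (countSub (isHC k)) (contract-edges es e u≢v)) (∑-sub-map (⟦_⟧ ∘ isHC k) (mapEdge (mergeMap u v u≢v)) rest))
  h-G-x : ∀ x → avoiding x uv ≡ nothing → h k (deleteVertex es x) ≡ without x
  h-G-x x drops-uv = begin
    h k (deleteVertex es x)                             ≡⟨ h≡countSub k n (edges (deleteVertex es x)) ⟩
    countSub (isHC k) (edges (deleteVertex es x))       ≡⟨ cong (countSub (isHC k)) (deleteVertex-edges es x) ⟩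
    countSub (isHC k) (mapMaybe (avoiding x) es)
      ≡⟨ ∑-sub-↭ (⟦_⟧ ∘ isHC k) (cong ⟦_⟧ ∘ isHC-↭ k) (↭P.mapMaybe-↭ (avoiding x) (lookup∷removeAt-↭ es e)) ⟩
    countSub (isHC k) (mapMaybe (avoiding x) (uv ∷ rest)) ≡⟨ cong (countSub (isHC k)) drop-uv ⟩
    countSub (isHC k) (mapMaybe (avoiding x) rest)       ≡⟨ countSub-mapMaybe (isHC k) (avoiding x) rest ⟩
    without x                                           ∎
    where
    drop-uv : mapMaybe (avoiding x) (uv ∷ rest) ≡ mapMaybe (avoiding x) rest
    drop-uv rewrite drops-uv = refl
  three-sums : ∑-sub (λ S → ⟦ isHC k (uv ∷ S) ⟧ + ⟦ avoids u S ⟧ + ⟦ avoids v S ⟧) rest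
               ≡ countSub (isHC k ∘ (uv ∷_)) rest + without u + without v
  three-sums = trans (∑-sub-+ (λ S → ⟦ isHC k (uv ∷ S) ⟧ + ⟦ avoids u S ⟧) (⟦_⟧ ∘ avoids v) rest)
                     (cong (_+ without v) (∑-sub-+ (⟦_⟧ ∘ isHC k ∘ (uv ∷_)) (⟦_⟧ ∘ avoids u) rest))
  regroup : ∀ a b c d → a + b + c + d ≡ b + (a + c + d)
  regroup = ℕ-Solver.solve-∀

-- Disjoint unions

degree-++ : ∀ {n} (A B : List (Edge n)) w → degree (A ++ B) w ≡ degree A w + degree B w
degree-++ [] B w = refl
degree-++ (e ∷ A) B w = trans (degree-∷ e (A ++ B) w) (trans (cong (edgeDegree e w +_) (degree-++ A B w))
  (trans (sym (ℕP.+-assoc (edgeDegree e w) _ _)) (cong (_+ degree B w) (sym (degree-∷ e A w)))))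

degree-map-miss : ∀ {n m} (g : Fin n → Fin m) (S : List (Edge n)) i → (∀ a → (g a == i) ≡ false) → degree (map (mapEdge g) S) i ≡ 0
degree-map-miss g []             i misses = refl
degree-map-miss g ((a , b) ∷ S) i misses =
  trans (degree-∷ (g a , g b) (map (mapEdge g) S) i) (cong₂ _+_ edge-misses (degree-map-miss g S i misses))
  where
  edge-misses : edgeDegree (g a , g b) i ≡ 0
  edge-misses rewrite misses a | misses b = refl

↑ˡ≢↑ʳ : ∀ {n m} (i : Fin n) (j : Fin m) → i ↑ˡ m ≢ n ↑ʳ j
↑ˡ≢↑ʳ {n} {m} i j i≡j with trans (sym (FinP.splitAt-↑ˡ n i m)) (trans (cong (Fin.splitAt n) i≡j) (FinP.splitAt-↑ʳ n m j))
... | ()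

↑-cases : ∀ {n m} (w : Fin (n + m)) → (∃ λ i → w ≡ i ↑ˡ m) ⊎ (∃ λ j → w ≡ n ↑ʳ j)
↑-cases {n} w with Fin.splitAt n w in eq
... | inj₁ i = inj₁ (i , sym (FinP.splitAt⁻¹-↑ˡ eq))
... | inj₂ j = inj₂ (j , sym (FinP.splitAt⁻¹-↑ʳ eq))

module DisjointUnion (n m : ℕ) (S : List (Edge n)) (T : List (Edge m)) where
  left right edges⊕ : List (Edge (n + m))
  left = map (mapEdge (_↑ˡ m)) S
  right = map (mapEdge (n ↑ʳ_)) T
  edges⊕ = left ++ right

  degree-left : ∀ i → degree edges⊕ (i ↑ˡ m) ≡ degree S i
  degree-left i = trans (degree-++ left right (i ↑ˡ m)) (trans (cong₂ _+_
    (degree-map-preimage (_↑ˡ m) S (i ↑ˡ m) i (λ a → ==-cong (FinP.↑ˡ-injective m a i) (cong (_↑ˡ m))))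
    (degree-map-miss (n ↑ʳ_) T (i ↑ˡ m) (λ b → ≢⇒==false (λ e → ↑ˡ≢↑ʳ i b (sym e))))) (ℕP.+-identityʳ _))

  degree-right : ∀ j → degree edges⊕ (n ↑ʳ j) ≡ degree T j
  degree-right j = trans (degree-++ left right (n ↑ʳ j)) (cong₂ _+_
    (degree-map-miss (_↑ˡ m) S (n ↑ʳ j) (λ a → ≢⇒==false (λ e → ↑ˡ≢↑ʳ a j e)))
    (degree-map-preimage (n ↑ʳ_) T (n ↑ʳ j) j (λ b → ==-cong (FinP.↑ʳ-injective n b j) (cong (n ↑ʳ_)))))

  twoRegular-⊕ : twoRegular edges⊕ ≡ twoRegular S ∧ twoRegular T
  twoRegular-⊕ = bool-ext fwd bwd
    where
    fwd : twoRegular edges⊕ ≡ true → twoRegular S ∧ twoRegular T ≡ true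
    fwd e = ∧-true (⇒twoRegular S λ i → trans (sym (degree-left i)) (two _)) (⇒twoRegular T λ j → trans (sym (degree-right j)) (two _))
      where two = twoRegular⇒ edges⊕ e
    bwd : twoRegular S ∧ twoRegular T ≡ true → twoRegular edges⊕ ≡ true
    bwd e = ⇒twoRegular edges⊕ two
      where
      reach-left = ∧≡true⇒ {twoRegular S} e
      two : TwoRegular edges⊕
      two w with ↑-cases {n} {m} w
      ... | inj₁ (i , refl) = trans (degree-left i) (twoRegular⇒ S (proj₁ reach-left) i)
      ... | inj₂ (j , refl) = trans (degree-right j) (twoRegular⇒ T (proj₂ reach-left) j)

  SameSide : Fin (n + m) → Fin (n + m) → Set
  SameSide a b = (∃ λ i → ∃ λ j → a ≡ i ↑ˡ m × b ≡ j ↑ˡ m × Conn S i j) ⊎ (∃ λ i → ∃ λ j → a ≡ n ↑ʳ i × b ≡ n ↑ʳ j × Conn T i j)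

  Conn⇒SameSide : ∀ {a b} → Conn edges⊕ a b → SameSide a b
  Conn⇒SameSide = Conn-elim SameSide same-refl same-sym same-trans same-edge
    where
    same-refl : ∀ {a} → SameSide a a
    same-refl {a} with ↑-cases {n} {m} a
    ... | inj₁ (i , e) = inj₁ (i , i , e , e , conn-refl)
    ... | inj₂ (j , e) = inj₂ (j , j , e , e , conn-refl)
    same-sym : ∀ {a b} → SameSide a b → SameSide b a
    same-sym (inj₁ (i , j , reach-left , reach-right , c)) = inj₁ (j , i , reach-right , reach-left , conn-sym c)
    same-sym (inj₂ (i , j , reach-left , reach-right , c)) = inj₂ (j , i , reach-right , reach-left , conn-sym c)
    same-trans : ∀ {a b c} → SameSide a b → SameSide b c → SameSide a c
    same-trans (inj₁ (i , j , reach-left , reach-right , c)) (inj₁ (j' , k , e3 , e4 , d)) =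
      inj₁ (i , k , reach-left , e4 , conn-trans c (subst (λ z → Conn S z k) (sym (FinP.↑ˡ-injective m j j' (trans (sym reach-right) e3))) d))
    same-trans (inj₁ (i , j , reach-left , reach-right , c)) (inj₂ (j' , k , e3 , e4 , d)) = ⊥-elim (↑ˡ≢↑ʳ j j' (trans (sym reach-right) e3))
    same-trans (inj₂ (i , j , reach-left , reach-right , c)) (inj₁ (j' , k , e3 , e4 , d)) = ⊥-elim (↑ˡ≢↑ʳ j' j (trans (sym e3) reach-right))
    same-trans (inj₂ (i , j , reach-left , reach-right , c)) (inj₂ (j' , k , e3 , e4 , d)) =
      inj₂ (i , k , reach-left , e4 , conn-trans c (subst (λ z → Conn T z k) (sym (FinP.↑ʳ-injective n j j' (trans (sym reach-right) e3))) d))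
    same-edge : ∀ {a b} → (a , b) ∈ edges⊕ → SameSide a b
    same-edge mem with ∈-++⁻ left mem
    ... | inj₁ ml = let (a , b , m' , reach-left , reach-right) = ∈-mapEdge⁻ (_↑ˡ m) ml in inj₁ (a , b , reach-left , reach-right , conn-edge m')
    ... | inj₂ mr = let (a , b , m' , reach-left , reach-right) = ∈-mapEdge⁻ (n ↑ʳ_) mr in inj₂ (a , b , reach-left , reach-right , conn-edge m')

  reach-left : ∀ i j → reach edges⊕ (i ↑ˡ m) (j ↑ˡ m) ≡ reach S i j
  reach-left i j = reach-cong edges⊕ S (i ↑ˡ m) (j ↑ˡ m) i j down up
    where
    down : Conn edges⊕ (i ↑ˡ m) (j ↑ˡ m) → Conn S i j
    down c with Conn⇒SameSide c
    ... | inj₁ (i' , j' , a , b , d) = subst₂ (Conn S) (FinP.↑ˡ-injective m i' i (sym a)) (FinP.↑ˡ-injective m j' j (sym b)) d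
    ... | inj₂ (i' , j' , a , b , d) = ⊥-elim (↑ˡ≢↑ʳ i i' a)
    up : Conn S i j → Conn edges⊕ (i ↑ˡ m) (j ↑ˡ m)
    up = Conn-map (_↑ˡ m) (λ mem → conn-edge (∈-++⁺ˡ (∈-mapEdge (_↑ˡ m) mem)))

  reach-right : ∀ i j → reach edges⊕ (n ↑ʳ i) (n ↑ʳ j) ≡ reach T i j
  reach-right i j = reach-cong edges⊕ T (n ↑ʳ i) (n ↑ʳ j) i j down up
    where
    down : Conn edges⊕ (n ↑ʳ i) (n ↑ʳ j) → Conn T i j
    down c with Conn⇒SameSide c
    ... | inj₁ (i' , j' , a , b , d) = ⊥-elim (↑ˡ≢↑ʳ i' i (sym a))
    ... | inj₂ (i' , j' , a , b , d) = subst₂ (Conn T) (FinP.↑ʳ-injective n i' i (sym a)) (FinP.↑ʳ-injective n j' j (sym b)) d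
    up : Conn T i j → Conn edges⊕ (n ↑ʳ i) (n ↑ʳ j)
    up = Conn-map (n ↑ʳ_) (λ mem → conn-edge (∈-++⁺ʳ left (∈-mapEdge (n ↑ʳ_) mem)))

  ¬reach-left-right : ∀ i j → reach edges⊕ (i ↑ˡ m) (n ↑ʳ j) ≡ false
  ¬reach-left-right i j = ≢true⇒ λ e → opposite (Conn⇒SameSide (reach⇒Conn edges⊕ _ _ e))
    where
    opposite : ¬ SameSide (i ↑ˡ m) (n ↑ʳ j)
    opposite (inj₁ (i' , j' , a , b , d)) = ↑ˡ≢↑ʳ j' j (sym b)
    opposite (inj₂ (i' , j' , a , b , d)) = ↑ˡ≢↑ʳ i i' a

  ¬reach-right-left : ∀ i j → reach edges⊕ (n ↑ʳ j) (i ↑ˡ m) ≡ false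
  ¬reach-right-left i j = ≢true⇒ λ e → opposite (Conn⇒SameSide (reach⇒Conn edges⊕ _ _ e))
    where
    opposite : ¬ SameSide (n ↑ʳ j) (i ↑ˡ m)
    opposite (inj₁ (i' , j' , a , b , d)) = ↑ˡ≢↑ʳ i' j (sym a)
    opposite (inj₂ (i' , j' , a , b , d)) = ↑ˡ≢↑ʳ i j' b

  components-⊕ : components edges⊕ ≡ components S + components T
  components-⊕ = classCount-↑ n m (reach edges⊕) (reach S) (reach T) reach-left reach-right ¬reach-left-right ¬reach-right-left

-- The polynomial H and its axioms

term : ∀ {n} → List (Edge n) → Poly
term S = s^ components S if twoRegular S

H : Graph → Poly
H (mkGraph n es) = ∑ₚ-sub term es

coeff-∑ₚ-sub : ∀ {A : Set} (f : List A → Poly) (g : List A → ℕ) k →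
               (∀ S → coeff (f S) k ≡ ℤ.+ g S) → ∀ xs → coeff (∑ₚ-sub f xs) k ≡ ℤ.+ ∑-sub g xs
coeff-∑ₚ-sub f g k fg []       = fg []
coeff-∑ₚ-sub f g k fg (x ∷ xs) =
  trans (coeff-+ₚ (∑ₚ-sub (f ∘ (x ∷_)) xs) (∑ₚ-sub f xs) k)
        (cong₂ ℤ._+_ (coeff-∑ₚ-sub (f ∘ (x ∷_)) (g ∘ (x ∷_)) k (fg ∘ (x ∷_)) xs) (coeff-∑ₚ-sub f g k fg xs))

coeff-H : ∀ G k → coeff (H G) k ≡ ℤ.+ h k G
coeff-H (mkGraph n es) k =
  trans (coeff-∑ₚ-sub term (⟦_⟧ ∘ isHC k) k (λ S → coeff-s^-if (components S) (twoRegular S) k) es)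
        (cong ℤ.+_ (sym (h≡countSub k n es)))

H-isoInvariant : IsoInvariant H
H-isoInvariant G G′ _ _ G≅G′ k = trans (coeff-H G k) (trans (cong ℤ.+_ (h-≅ k G G′ G≅G′)) (sym (coeff-H G′ k)))

H-deletion-contraction : Axiom1 H
H-deletion-contraction n es e u≢v k = begin
  coeff (H G) k                                                      ≡⟨ coeff-H G k ⟩
  ℤ.+ h k G                                                          ≡⟨ isolate (h k G) (h k G-e) (h k G/e) (h k G-u) (h k G-v) (h-deletion-contraction k n es e u≢v) ⟩
  ℤ.+ h k G-e ℤ.+ ℤ.+ h k G/e ℤ.- ℤ.+ h k G-u ℤ.- ℤ.+ h k G-v
    ≡⟨ cong₂ ℤ._-_ (cong₂ ℤ._-_ (cong₂ ℤ._+_ (coeff-H G-e k) (coeff-H G/e k)) (coeff-H G-u k)) (coeff-H G-v k) ⟨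
  coeff (H G-e) k ℤ.+ coeff (H G/e) k ℤ.- coeff (H G-u) k ℤ.- coeff (H G-v) k
    ≡⟨ cong (λ x → x ℤ.- coeff (H G-u) k ℤ.- coeff (H G-v) k) (coeff-+ₚ (H G-e) (H G/e) k) ⟨
  coeff (H G-e +ₚ H G/e) k ℤ.- coeff (H G-u) k ℤ.- coeff (H G-v) k
    ≡⟨ cong (ℤ._- coeff (H G-v) k) (coeff-subₚ (H G-e +ₚ H G/e) (H G-u) k) ⟨
  coeff (H G-e +ₚ H G/e -ₚ H G-u) k ℤ.- coeff (H G-v) k
    ≡⟨ coeff-subₚ (H G-e +ₚ H G/e -ₚ H G-u) (H G-v) k ⟨
  coeff (H G-e +ₚ H G/e -ₚ H G-u -ₚ H G-v) k                           ∎
  where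
  open ≡-Reasoning
  G = mkGraph (suc n) es
  G-e = deleteEdge G e
  G/e = contract es e u≢v
  G-u = deleteVertex es (proj₁ (lookup es e))
  G-v = deleteVertex es (proj₂ (lookup es e))
  isolate : ∀ a b c d e → a + d + e ≡ b + c → ℤ.+ a ≡ ℤ.+ b ℤ.+ ℤ.+ c ℤ.- ℤ.+ d ℤ.- ℤ.+ e
  isolate a b c d e eq = trans (cancel (ℤ.+ a) (ℤ.+ d) (ℤ.+ e)) (cong (λ x → x ℤ.- ℤ.+ d ℤ.- ℤ.+ e) eqℤ)
    where
    cancel : ∀ a d e → a ≡ a ℤ.+ d ℤ.+ e ℤ.- d ℤ.- e
    cancel = ℤ-Solver.solve-∀
    eqℤ : ℤ.+ a ℤ.+ ℤ.+ d ℤ.+ ℤ.+ e ≡ ℤ.+ b ℤ.+ ℤ.+ c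
    eqℤ = trans (cong (ℤ._+ ℤ.+ e) (sym (ℤP.pos-+ a d)))
                (trans (sym (ℤP.pos-+ (a + d) e)) (trans (cong ℤ.+_ eq) (ℤP.pos-+ b c)))

H-⊕ : Axiom2 H
H-⊕ (mkGraph n es₁) (mkGraph m es₂) _ _ = get (begin
  ∑ₚ-sub term (L ++ R)                                        ≡⟨ ∑ₚ-sub-++ term L R ⟩
  ∑ₚ-sub (λ S → ∑ₚ-sub (λ T → term (S ++ T)) R) L               ≡⟨ ∑ₚ-sub-map _ (mapEdge (_↑ˡ m)) es₁ ⟩
  ∑ₚ-sub (λ S → ∑ₚ-sub (λ T → term (map (mapEdge (_↑ˡ m)) S ++ T)) R) es₁
    ≈⟨ ∑ₚ-sub-cong (λ S → mk≋ λ k → cong (λ p → coeff p k) (∑ₚ-sub-map _ (mapEdge (n ↑ʳ_)) es₂)) es₁ ⟩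
  ∑ₚ-sub (λ S → ∑ₚ-sub (λ T → term (DisjointUnion.edges⊕ n m S T)) es₂) es₁
    ≈⟨ ∑ₚ-sub-cong (λ S → ∑ₚ-sub-cong (term-⊕ S) es₂) es₁ ⟩
  ∑ₚ-sub (λ S → ∑ₚ-sub (λ T → term S *ₚ term T) es₂) es₁      ≈⟨ ∑ₚ-sub-cong (λ S → ∑ₚ-sub-*ₚˡ (term S) term es₂) es₁ ⟨
  ∑ₚ-sub (λ S → term S *ₚ ∑ₚ-sub term es₂) es₁                 ≈⟨ ∑ₚ-sub-*ₚʳ term (∑ₚ-sub term es₂) es₁ ⟨
  ∑ₚ-sub term es₁ *ₚ ∑ₚ-sub term es₂                            ∎)
  where
  open import Relation.Binary.Reasoning.Setoid ≋-setoid
  L = map (mapEdge (_↑ˡ m)) es₁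
  R = map (mapEdge (n ↑ʳ_)) es₂
  term-⊕ : ∀ S T → term (DisjointUnion.edges⊕ n m S T) ≋ term S *ₚ term T
  term-⊕ S T = ≋-trans (mk≋ λ k → cong (λ p → coeff p k) (cong₂ s^_if_ (DisjointUnion.components-⊕ n m S T) (DisjointUnion.twoRegular-⊕ n m S T)))
                       (s^-if-* (components S) (components T) (twoRegular S) (twoRegular T))

isHC-one-vertex : ∀ k (S : List (Edge 1)) → isHC k S ≡ ⌊ length S ℕ.≟ 1 ⌋ ∧ ⌊ 1 ℕ.≟ k ⌋
isHC-one-vertex k S =
  cong (_∧ ⌊ 1 ℕ.≟ k ⌋) (trans (twoRegular-allF S) (trans (BoolP.∧-identityʳ _)
                         (trans (cong (λ d → ⌊ d ℕ.≟ 2 ⌋) (degree-loops S)) (double≡2 (length S)))))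
  where
  degree-loops : ∀ (S : List (Edge 1)) → degree S zero ≡ length S + length S
  degree-loops []                  = refl
  degree-loops ((zero , zero) ∷ S) =
    trans (degree-∷ (zero , zero) S zero) (trans (cong (2 +_) (degree-loops S)) (cong suc (sym (ℕP.+-suc (length S) (length S)))))
  double≡2 : ∀ l → ⌊ l + l ℕ.≟ 2 ⌋ ≡ ⌊ l ℕ.≟ 1 ⌋
  double≡2 0 = refl
  double≡2 1 = refl
  double≡2 (suc (suc l)) rewrite ℕP.+-suc l (suc l) = refl

∑-sub-replicate : ∀ {A : Set} n (x : A) (f : ℕ → ℕ) → (∀ j → f (suc (suc j)) ≡ 0) →
                  ∑-sub (f ∘ length) (replicate n x) ≡ f 0 + n ℕ.* f 1
∑-sub-replicate zero    x f f≥2 = sym (ℕP.+-identityʳ (f 0))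
∑-sub-replicate (suc n) x f f≥2 =
  trans (cong₂ _+_ (∑-sub-replicate n x (f ∘ suc) (f≥2 ∘ suc)) (∑-sub-replicate n x f f≥2))
        (trans (cong (λ c → f 1 + n ℕ.* c + (f 0 + n ℕ.* f 1)) (f≥2 0)) (rearrange (f 0) (f 1) n))
  where
  rearrange : ∀ a b n → b + n ℕ.* 0 + (a + n ℕ.* b) ≡ a + (b + n ℕ.* b)
  rearrange = ℕ-Solver.solve-∀

H-K1^ : Axiom3 H
H-K1^ n k = begin
  coeff (H (K1^ n)) k                                   ≡⟨ coeff-H (K1^ n) k ⟩
  ℤ.+ h k (K1^ n)                                       ≡⟨ cong ℤ.+_ (h≡countSub k 1 loops) ⟩
  ℤ.+ ∑-sub (⟦_⟧ ∘ isHC k) loops                        ≡⟨ cong ℤ.+_ (∑-sub-cong (λ S → cong ⟦_⟧ (isHC-one-vertex k S)) loops) ⟩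
  ℤ.+ ∑-sub (single ∘ length) loops                     ≡⟨ cong ℤ.+_ (∑-sub-replicate n (zero , zero) single (λ _ → refl)) ⟩
  ℤ.+ (n ℕ.* ⟦ ⌊ 1 ℕ.≟ k ⌋ ⟧)                             ≡⟨ coeff-nS k ⟩
  coeff (nS n) k                                        ∎
  where
  open ≡-Reasoning
  loops = replicate n (zero , zero)
  single : ℕ → ℕ
  single l = ⟦ ⌊ l ℕ.≟ 1 ⌋ ∧ ⌊ 1 ℕ.≟ k ⌋ ⟧
  coeff-nS : ∀ k → ℤ.+ (n ℕ.* ⟦ ⌊ 1 ℕ.≟ k ⌋ ⟧) ≡ coeff (nS n) k
  coeff-nS zero          = cong ℤ.+_ (ℕP.*-zeroʳ n)
  coeff-nS (suc zero)    = cong ℤ.+_ (ℕP.*-identityʳ n)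
  coeff-nS (suc (suc k)) = cong ℤ.+_ (ℕP.*-zeroʳ n)

H-admissible : Admissible H
H-admissible = H-isoInvariant , H-deletion-contraction , H-⊕ , H-K1^

-- Uniqueness

IsLoop : ∀ {n} → Edge n → Set
IsLoop (a , b) = a ≡ b

nonLoop? : ∀ {n} (es : List (Edge n)) →
           (Σ (Fin (length es)) λ e → proj₁ (lookup es e) ≢ proj₂ (lookup es e)) ⊎ All IsLoop es
nonLoop? []             = inj₂ []
nonLoop? ((a , b) ∷ es) with a FinP.≟ b
... | no a≢b  = inj₁ (zero , a≢b)
... | yes refl with nonLoop? es
...   | inj₁ (e , u≢v) = inj₁ (suc e , u≢v)
...   | inj₂ loops     = inj₂ (refl ∷ loops)

split-loops : ∀ {n} (es : List (Edge (suc (suc n)))) → All IsLoop es →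
              Σ ℕ λ a → Σ (List (Edge (suc n))) λ es′ →
                (es ↭ replicate a (zero , zero) ++ map (mapEdge suc) es′) × length es′ ≤ length es
split-loops []                        []            = 0 , [] , ↭.refl , z≤n
split-loops ((zero , .zero) ∷ es)     (refl ∷ loops) with split-loops es loops
... | a , es′ , es↭ , ≤len = suc a , es′ , prep _ es↭ , ℕP.m≤n⇒m≤1+n ≤len
split-loops ((suc y , .(suc y)) ∷ es) (refl ∷ loops) with split-loops es loops
... | a , es′ , es↭ , ≤len =
  a , (y , y) ∷ es′ ,
  ↭-trans (prep _ es↭) (↭-sym (↭P.shift (suc y , suc y) (replicate a (zero , zero)) (map (mapEdge suc) es′))) ,
  s≤s ≤len

one-vertex-loops : (es : List (Edge 1)) → es ≡ replicate (length es) (zero , zero)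
one-vertex-loops []                  = refl
one-vertex-loops ((zero , zero) ∷ es) = cong (_ ∷_) (one-vertex-loops es)

loops-≅ : ∀ {n} (es : List (Edge (suc (suc n)))) a es′ →
          es ↭ replicate a (zero , zero) ++ map (mapEdge suc) es′ →
          mkGraph (suc (suc n)) es ≅ (K1^ a ⊕ mkGraph (suc n) es′)
loops-≅ {n} es a es′ es↭ =
  ↔-id _ , es , SameEnds-refl es ,
  ↭-trans es↭ (↭P.++⁺ʳ _ (↭.↭-reflexive (sym (ListP.map-replicate (mapEdge (_↑ˡ suc n)) a (zero , zero)))))
  where
  SameEnds-refl : ∀ (es : List (Edge (suc (suc n)))) → Pointwise SameEnds (map id es) es
  SameEnds-refl []       = []
  SameEnds-refl (_ ∷ es) = inj₁ (refl , refl) ∷ SameEnds-refl es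

≢⇒nonEmpty : ∀ {n} {u v : Fin (suc n)} → u ≢ v → NonEmpty (mkGraph n [])
≢⇒nonEmpty {zero}  {zero} {zero} u≢v = ⊥-elim (u≢v refl)
≢⇒nonEmpty {suc n}               _   = s≤s z≤n

module AdmissibleLaws (F : Graph → Poly) (admissible : Admissible F) where

  ≅-invariant : ∀ G G′ → NonEmpty G → NonEmpty G′ → G ≅ G′ → F G ≋ F G′
  ≅-invariant G G′ ne ne′ G≅G′ = mk≋ (proj₁ admissible G G′ ne ne′ G≅G′)

  deletion-contraction : ∀ n (es : List (Edge (suc n))) (e : Fin (length es)) (u≢v : proj₁ (lookup es e) ≢ proj₂ (lookup es e)) →
                         F (mkGraph (suc n) es) ≋
                           F (deleteEdge (mkGraph (suc n) es) e) +ₚ F (contract es e u≢v)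
                             -ₚ F (deleteVertex es (proj₁ (lookup es e)))
                             -ₚ F (deleteVertex es (proj₂ (lookup es e)))
  deletion-contraction n es e u≢v = mk≋ (proj₁ (proj₂ admissible) n es e u≢v)

  multiplicative : ∀ G₁ G₂ → NonEmpty G₁ → NonEmpty G₂ → F (G₁ ⊕ G₂) ≋ F G₁ *ₚ F G₂
  multiplicative G₁ G₂ ne₁ ne₂ = mk≋ (proj₁ (proj₂ (proj₂ admissible)) G₁ G₂ ne₁ ne₂)

  loops : ∀ n → F (K1^ n) ≋ nS n
  loops n = mk≋ (proj₂ (proj₂ (proj₂ admissible)) n)

module Uniqueness (F F′ : Graph → Poly) (admissible : Admissible F) (admissible′ : Admissible F′) where

  open AdmissibleLaws F admissible
  open AdmissibleLaws F′ admissible′ using () renaming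
    (≅-invariant to ≅-invariant′; deletion-contraction to deletion-contraction′; multiplicative to multiplicative′; loops to loops′)
  open import Relation.Binary.Reasoning.Setoid ≋-setoid

  size : Graph → ℕ
  size G = nV G + length (edges G)

  agree-below : ∀ m G → size G < m → NonEmpty G → F G ≋ F′ G
  agree-below (suc m) (mkGraph (suc n) es) (s≤s small) _ with nonLoop? es
  ... | inj₁ (e , u≢v) = begin
    F (mkGraph (suc n) es)                        ≈⟨ deletion-contraction n es e u≢v ⟩
    F G-e +ₚ F G/e -ₚ F G-u -ₚ F G-v              ≈⟨ -ₚ-cong (-ₚ-cong (+ₚ-cong (IH G-e small-e (s≤s z≤n)) (IH G/e small-/ nonEmpty))
                                                                       (IH G-u (small-avoiding _) nonEmpty))
                                                              (IH G-v (small-avoiding _) nonEmpty) ⟩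
    F′ G-e +ₚ F′ G/e -ₚ F′ G-u -ₚ F′ G-v          ≈⟨ deletion-contraction′ n es e u≢v ⟨
    F′ (mkGraph (suc n) es)                       ∎
    where
    IH = agree-below m
    G-e = deleteEdge (mkGraph (suc n) es) e
    G/e = contract es e u≢v
    G-u = deleteVertex es (proj₁ (lookup es e))
    G-v = deleteVertex es (proj₂ (lookup es e))
    nonEmpty : 1 ≤ n
    nonEmpty = ≢⇒nonEmpty u≢v
    small-e : suc n + length (removeAt es e) < m
    small-e = ℕP.<-≤-trans (ℕP.+-monoʳ-< (suc n) (ℕP.≤-reflexive (sym (ListP.length-removeAt′ es e)))) small
    small-/ : n + length (map _ (removeAt es e)) < m
    small-/ = ℕP.<-≤-trans (ℕP.+-mono-<-≤ (ℕP.n<1+n n)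
                (ℕP.≤-trans (ℕP.≤-reflexive (ListP.length-map _ (removeAt es e)))
                  (ℕP.≤-trans (ℕP.n≤1+n _) (ℕP.≤-reflexive (sym (ListP.length-removeAt′ es e)))))) small
    small-avoiding : ∀ f → n + length (mapMaybe f es) < m
    small-avoiding f = ℕP.<-≤-trans (ℕP.+-mono-<-≤ (ℕP.n<1+n n) (ListP.length-mapMaybe f es)) small
  agree-below (suc m) (mkGraph 1 es) _ _ | inj₂ _ =
    subst (λ es → F (mkGraph 1 es) ≋ F′ (mkGraph 1 es)) (sym (one-vertex-loops es))
          (≋-trans (loops (length es)) (≋-sym (loops′ (length es))))
  agree-below (suc m) (mkGraph (suc (suc n)) es) (s≤s small) nonEmpty | inj₂ all-loops
    with split-loops es all-loops
  ... | a , es′ , es↭ , ≤len = begin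
    F G                  ≈⟨ ≅-invariant G (K1^ a ⊕ G′) nonEmpty (s≤s z≤n) (loops-≅ es a es′ es↭) ⟩
    F (K1^ a ⊕ G′)       ≈⟨ multiplicative (K1^ a) G′ (s≤s z≤n) (s≤s z≤n) ⟩
    F (K1^ a) *ₚ F G′    ≈⟨ *ₚ-cong (≋-trans (loops a) (≋-sym (loops′ a))) (agree-below m G′ small′ (s≤s z≤n)) ⟩
    F′ (K1^ a) *ₚ F′ G′  ≈⟨ multiplicative′ (K1^ a) G′ (s≤s z≤n) (s≤s z≤n) ⟨
    F′ (K1^ a ⊕ G′)      ≈⟨ ≅-invariant′ G (K1^ a ⊕ G′) nonEmpty (s≤s z≤n) (loops-≅ es a es′ es↭) ⟨
    F′ G                 ∎
    where
    G = mkGraph (suc (suc n)) es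
    G′ = mkGraph (suc n) es′
    small′ : suc n + length es′ < m
    small′ = ℕP.<-≤-trans (ℕP.+-mono-<-≤ (ℕP.n<1+n (suc n)) ≤len) small

  agree : ∀ G → NonEmpty G → F G ≈ₚ F′ G
  agree G nonEmpty = get (agree-below (suc (size G)) G ℕP.≤-refl nonEmpty)

-- Opened only here: with ℤ's +_ in scope, sections of ℕ's _+_ such as (a +_) are ambiguous.
open import Data.Integer using (+_)

theorem2 : Σ (Graph → Poly) λ H →
             Admissible H
             × (∀ H' → Admissible H' → ∀ G → NonEmpty G → H G ≈ₚ H' G)
             × (∀ G → NonEmpty G → ∀ (k : ℕ) → coeff (H G) k ≡ + (h k G))
theorem2 = H , H-admissible , (λ H′ admissible′ → Uniqueness.agree H H′ H-admissible admissible′) , (λ G _ → coeff-H G)
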